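{- Let $C$ be a caterpillar. Then the leaf word $\Delta L_C$ is prefix normal.
   Context: All graphs are finite, simple, undirected. A caterpillar is a tree whose non-leaf vertices induce a path. For a graph $G$ with $n$ vertices, $L_G(i)$ ($0\le i\le n$) is the maximum number of leaves (degree-1 vertices) of an induced subtree of $G$ with exactly $i$ vertices ($-\infty$ if none). The leaf word $\Delta L_G$ is the word of length $n-3$ whose $i$-th letter ($1\le i\le n-3$) is $L_G(i+3)-L_G(i+2)$ (or a symbol $\omega$ if one of these is $-\infty$); for trees it is a word over $\{0,1\}$. A binary word $u$ is prefix normal if for every prefix $p$ and factor $f$ of $u$ with $|p|=|f|$, the number of $1$'s in $p$ is at least that in $f$. -}

module Defs where

open import Data.Nat using (ℕ; zero; suc; _+_; _≤_; _<_; _∸_; _≡ᵇ_)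
open import Data.Bool using (Bool; true; false; T; _∧_; not; if_then_else_)
open import Data.Fin using (Fin; toℕ)
open import Data.Fin.Subset using (Subset; _∈_; _∉_; ∣_∣)
open import Data.Vec using (Vec; lookup; tabulate)
open import Data.List using (List; []; _∷_; _++_; length; take; drop)
import Data.List as L
open import Data.List.Relation.Unary.All using (All)
open import Data.List.Relation.Unary.Unique.Propositional using (Unique)
open import Data.List.Relation.Unary.Linked using (Linked)
import Data.List.Membership.Propositional as LM
open import Data.Product using (Σ; ∃; _×_; _,_)
open import Relation.Nullary using (¬_)
open import Relation.Binary.PropositionalEquality using (_≡_)
open import Function.Bundles using (_⇔_)

record Graph (n : ℕ) : Set where
  field
    adj    : Fin n → Fin n → Bool
    sym    : ∀ u v → adj u v ≡ adj v u
    irrefl : ∀ v → adj v v ≡ false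

module _ {n : ℕ} (G : Graph n) where
  open Graph G

  Adj : Fin n → Fin n → Set
  Adj u v = T (adj u v)

  degIn : Subset n → Fin n → ℕ
  degIn S v = ∣ tabulate (λ w → lookup S w ∧ adj v w) ∣

  data WalkIn (S : Subset n) : Fin n → Fin n → Set where
    here : ∀ {u} → u ∈ S → WalkIn S u u
    step : ∀ {u w v} → u ∈ S → Adj u w → WalkIn S w v → WalkIn S u v

  ConnectedIn : Subset n → Set
  ConnectedIn S = ∀ u v → u ∈ S → v ∈ S → WalkIn S u v

  CycleIn : Subset n → Set
  CycleIn S = Σ (Fin n) λ v₀ → Σ (List (Fin n)) λ rest →
    (2 ≤ length rest) × All (_∈ S) (v₀ ∷ rest) × Unique (v₀ ∷ rest)
    × Linked Adj ((v₀ ∷ rest) ++ (v₀ ∷ []))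

  InducesTree : Subset n → Set
  InducesTree S = ConnectedIn S × ¬ CycleIn S

  leavesIn : Subset n → ℕ
  leavesIn S = ∣ tabulate (λ v → lookup S v ∧ (degIn S v ≡ᵇ 1)) ∣

  InducesPath : Subset n → Set
  InducesPath S = Σ (List (Fin n)) λ ps →
    Unique ps × (∀ v → (v ∈ S) ⇔ (v LM.∈ ps)) × Linked Adj ps
    × (∀ (i j : Fin (length ps)) → suc (toℕ i) < toℕ j →
         ¬ Adj (L.lookup ps i) (L.lookup ps j))

  allVertices : Subset n
  allVertices = tabulate (λ _ → true)

  IsTree : Set
  IsTree = InducesTree allVertices

  nonLeaves : Subset n
  nonLeaves = tabulate (λ v → not (degIn allVertices v ≡ᵇ 1))

  IsCaterpillar : Set
  IsCaterpillar = IsTree × InducesPath nonLeaves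

  -- L_G(i) = m  (finite value): some induced subtree with i vertices has m leaves,
  -- and every induced subtree with i vertices has at most m leaves
  IsLG : ℕ → ℕ → Set
  IsLG i m = (Σ (Subset n) λ S → InducesTree S × ∣ S ∣ ≡ i × leavesIn S ≡ m)
           × (∀ S → InducesTree S → ∣ S ∣ ≡ i → leavesIn S ≤ m)

  -- w is the leaf word ΔL_G (with all letters binary): |w| = n - 3 and its k-th letter
  -- (0-based k, i.e. letter k+1) equals L_G(k+4) - L_G(k+3), both finite
  IsLeafWord : List Bool → Set
  IsLeafWord w = length w ≡ n ∸ 3 ×
    (∀ (k : Fin (length w)) → Σ ℕ λ a → Σ ℕ λ b →
       IsLG (toℕ k + 3) a × IsLG (toℕ k + 4) b ×
       b ≡ a + (if L.lookup w k then 1 else 0))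

ones : List Bool → ℕ
ones [] = 0
ones (true ∷ w) = suc (ones w)
ones (false ∷ w) = ones w

PrefixNormal : List Bool → Set
PrefixNormal w = ∀ (i k : ℕ) → i + k ≤ length w →
  ones (take k (drop i w)) ≤ ones (take k w)

-- The non-leaves of a caterpillar form an induced path, the spine. Let M m be the largest
-- number of vertices in the closed neighbourhood of m consecutive spine vertices. The internal
-- vertices of an induced subtree with s ≥ 3 vertices contain a run of ℓ consecutive spine
-- vertices whose neighbourhood contains the subtree; so s ≤ M ℓ and the subtree has at most
-- s - ℓ leaves. Conversely, pruning leaves of a largest neighbourhood reaches every smaller
-- size. Hence L(s) = s - c(s) with c(s) the least m such that s ≤ M m, and the letter
-- L(s + 1) - L(s) is 0 exactly when s is one of M 1, …, M (k - 1). The function M is strictly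
-- increasing and satisfies M (a + b) + 2 ≤ M a + M b. If the prefix of length l has q zeros,
-- then M 1, …, M q < 3 + l; for the factor whose letters start at L(c + 1) - L(c), take the
-- least m₀ with c ≤ M m₀: subadditivity puts M m₀, …, M (m₀ + q - 1) into [c, c + l), so the
-- factor has at least q zeros too.

module Submission where

open import Data.Nat
open import Data.Nat.Properties
open import Data.Nat.Solver using (module +-*-Solver)
open import Algebra.Properties.CommutativeSemigroup +-commutativeSemigroup using (interchange)
open import Data.Bool using (Bool; true; false; T; _∧_; _∨_; not; if_then_else_)
open import Data.Bool.Properties using (T?; ∧-zeroʳ; ∧-identityʳ)
open import Data.Fin using (Fin; zero; suc; toℕ; fromℕ<)
import Data.Fin.Properties as Fin
open import Data.Fin.Subset using (Subset; _∈_; ∣_∣)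
open import Data.Fin.Subset.Properties using (_∈?_)
open import Data.Vec using (tabulate; lookup)
open import Data.Vec.Properties using (tabulate∘lookup; lookup∘tabulate; []=⇒lookup; lookup⇒[]=)
open import Data.List using (List; []; _∷_; length; take; drop)
import Data.List as List
open import Data.List.Membership.Propositional using () renaming (_∈_ to _∈ₗ_)
open import Data.List.Relation.Unary.Any using (here; there)
open import Data.List.Relation.Unary.All using (All; []; _∷_)
import Data.List.Relation.Unary.All as All
open import Data.List.Relation.Unary.AllPairs using (_∷_)
open import Data.List.Relation.Unary.Unique.Propositional using (Unique)
open import Data.List.Relation.Unary.Linked using (Linked; [-]; _∷_)
open import Data.Product using (Σ; ∃; _×_; _,_; proj₁; proj₂)
open import Data.Sum using (_⊎_; inj₁; inj₂)
open import Data.Empty using (⊥-elim)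
open import Data.Unit using (tt)
open import Relation.Nullary using (¬_; Dec; yes; no; _×-dec_)
open import Relation.Nullary.Decidable using (isYes; toWitness; fromWitness; fromWitnessFalse)
open import Relation.Unary using (Decidable)
open import Relation.Binary.PropositionalEquality
open import Relation.Binary.Definitions using (tri<; tri≈; tri>)
open import Function using (_∘_; case_of_)
open import Function.Bundles using (Equivalence; _⇔_)
open import Defs

∧-intro : ∀ {a b} → T a → T b → T (a ∧ b)
∧-intro {true} {true} _ _ = tt

∧-elimˡ : ∀ {a b} → T (a ∧ b) → T a
∧-elimˡ {true} _ = tt

∧-elimʳ : ∀ {a b} → T (a ∧ b) → T b
∧-elimʳ {true} t = t

not-intro : ∀ {a} → ¬ T a → T (not a)
not-intro {false} _ = tt
not-intro {true} h = h tt

not-elim : ∀ {a} → T (not a) → ¬ T a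
not-elim {false} _ ()

∨-introˡ : ∀ {a b} → T a → T (a ∨ b)
∨-introˡ {true} _ = tt

∨-introʳ : ∀ {a b} → T b → T (a ∨ b)
∨-introʳ {false} t = t
∨-introʳ {true} _ = tt

∨-elim : ∀ {a b} → T (a ∨ b) → T a ⊎ T b
∨-elim {false} t = inj₂ t
∨-elim {true} _ = inj₁ tt

T-ext : ∀ {a b} → (T a → T b) → (T b → T a) → a ≡ b
T-ext {false} {false} _ _ = refl
T-ext {false} {true} _ b⇒a = ⊥-elim (b⇒a tt)
T-ext {true} {false} a⇒b _ = ⊥-elim (a⇒b tt)
T-ext {true} {true} _ _ = refl

boolToℕ : Bool → ℕ
boolToℕ false = 0
boolToℕ true = 1

boolToℕ-mono : ∀ {a b} → (T a → T b) → boolToℕ a ≤ boolToℕ b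
boolToℕ-mono {false} h = z≤n
boolToℕ-mono {true} {true} h = ≤-refl
boolToℕ-mono {true} {false} h = ⊥-elim (h tt)

boolToℕ≤1 : ∀ b → boolToℕ b ≤ 1
boolToℕ≤1 false = z≤n
boolToℕ≤1 true = ≤-refl

-- Counting

count : ∀ {n} → (Fin n → Bool) → ℕ
count {zero} f = 0
count {suc n} f = boolToℕ (f zero) + count (f ∘ suc)

∣tabulate∣≡count : ∀ {n} (f : Fin n → Bool) → ∣ tabulate f ∣ ≡ count f
∣tabulate∣≡count {zero} f = refl
∣tabulate∣≡count {suc n} f with f zero
... | true = cong suc (∣tabulate∣≡count (f ∘ suc))
... | false = ∣tabulate∣≡count (f ∘ suc)

∣p∣≡count : ∀ {n} (p : Subset n) → ∣ p ∣ ≡ count (lookup p)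
∣p∣≡count p = trans (cong ∣_∣ (sym (tabulate∘lookup p))) (∣tabulate∣≡count (lookup p))

count-cong : ∀ {n} {f g : Fin n → Bool} → (∀ v → f v ≡ g v) → count f ≡ count g
count-cong {zero} e = refl
count-cong {suc n} e = cong₂ _+_ (cong boolToℕ (e zero)) (count-cong (e ∘ suc))

count-mono : ∀ {n} (f g : Fin n → Bool) → (∀ v → T (f v) → T (g v)) → count f ≤ count g
count-mono {zero} f g h = z≤n
count-mono {suc n} f g h = +-mono-≤ (boolToℕ-mono (h zero)) (count-mono (f ∘ suc) (g ∘ suc) (h ∘ suc))

count-none : ∀ {n} (f : Fin n → Bool) → (∀ v → ¬ T (f v)) → count f ≡ 0
count-none {zero} f h = refl
count-none {suc n} f h with f zero | h zero
... | true | h₀ = ⊥-elim (h₀ tt)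
... | false | _ = count-none (f ∘ suc) (h ∘ suc)

count-all : ∀ {n} (f : Fin n → Bool) → (∀ v → T (f v)) → count f ≡ n
count-all {zero} f h = refl
count-all {suc n} f h with f zero | h zero
... | true | _ = cong suc (count-all (f ∘ suc) (h ∘ suc))

count-witness : ∀ {n} (f : Fin n → Bool) → 1 ≤ count f → ∃ λ v → T (f v)
count-witness {suc n} f h with f zero in eq
... | true = zero , subst T (sym eq) tt
... | false with count-witness (f ∘ suc) h
...   | v , fv = suc v , fv

boolToℕ-split : ∀ a b → boolToℕ a ≡ boolToℕ (a ∧ b) + boolToℕ (a ∧ not b)
boolToℕ-split true true = refl
boolToℕ-split true false = refl
boolToℕ-split false b = refl

count-split : ∀ {n} (f g : Fin n → Bool) →
  count f ≡ count (λ v → f v ∧ g v) + count (λ v → f v ∧ not (g v))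
count-split {zero} f g = refl
count-split {suc n} f g =
  trans (cong₂ _+_ (boolToℕ-split (f zero) (g zero)) (count-split (f ∘ suc) (g ∘ suc)))
        (interchange (boolToℕ (f zero ∧ g zero)) (boolToℕ (f zero ∧ not (g zero))) _ _)

boolToℕ-∨+∧ : ∀ a b → boolToℕ (a ∨ b) + boolToℕ (a ∧ b) ≡ boolToℕ a + boolToℕ b
boolToℕ-∨+∧ true true = refl
boolToℕ-∨+∧ true false = refl
boolToℕ-∨+∧ false true = refl
boolToℕ-∨+∧ false false = refl

count-∨+count-∧ : ∀ {n} (f g : Fin n → Bool) →
  count (λ v → f v ∨ g v) + count (λ v → f v ∧ g v) ≡ count f + count g
count-∨+count-∧ {zero} f g = refl
count-∨+count-∧ {suc n} f g = begin
  (boolToℕ (f zero ∨ g zero) + _) + (boolToℕ (f zero ∧ g zero) + _)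
    ≡⟨ interchange (boolToℕ (f zero ∨ g zero)) _ _ _ ⟩
  (boolToℕ (f zero ∨ g zero) + boolToℕ (f zero ∧ g zero))
    + (count (λ v → f (suc v) ∨ g (suc v)) + count (λ v → f (suc v) ∧ g (suc v)))
    ≡⟨ cong₂ _+_ (boolToℕ-∨+∧ (f zero) (g zero)) (count-∨+count-∧ (f ∘ suc) (g ∘ suc)) ⟩
  (boolToℕ (f zero) + boolToℕ (g zero)) + (count (f ∘ suc) + count (g ∘ suc))
    ≡⟨ interchange (boolToℕ (f zero)) _ _ _ ⟩
  count f + count g ∎
  where open ≡-Reasoning

_≟ᵇ_ : ∀ {n} → Fin n → Fin n → Bool
u ≟ᵇ v = isYes (u Fin.≟ v)

≟ᵇ-refl : ∀ {n} (u : Fin n) → T (u ≟ᵇ u)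
≟ᵇ-refl u = fromWitness {a? = u Fin.≟ u} refl

≟ᵇ⇒≡ : ∀ {n} (u v : Fin n) → T (u ≟ᵇ v) → u ≡ v
≟ᵇ⇒≡ u v = toWitness {a? = u Fin.≟ v}

count-≟ᵇ : ∀ {n} (u : Fin n) → count (_≟ᵇ u) ≡ 1
count-≟ᵇ {suc n} zero =
  cong suc (count-none {n} (λ v → suc v ≟ᵇ zero) λ v t → Fin.0≢1+n (sym (≟ᵇ⇒≡ (suc v) zero t)))
count-≟ᵇ {suc n} (suc u) = trans (count-cong (≟ᵇ-suc u)) (count-≟ᵇ u)
  where
  ≟ᵇ-suc : ∀ {n} (u v : Fin n) → (suc v ≟ᵇ suc u) ≡ (v ≟ᵇ u)
  ≟ᵇ-suc u v with v Fin.≟ u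
  ... | yes _ = refl
  ... | no _ = refl

count≤1 : ∀ {n} (f : Fin n → Bool) (u : Fin n) → (∀ v → T (f v) → v ≡ u) → count f ≤ 1
count≤1 f u h =
  ≤-trans (count-mono f (_≟ᵇ u) λ v fv → subst (λ w → T (w ≟ᵇ u)) (sym (h v fv)) (≟ᵇ-refl u))
          (≤-reflexive (count-≟ᵇ u))

count-remove : ∀ {n} (f : Fin n → Bool) {u} → T (f u) →
  count f ≡ suc (count (λ v → f v ∧ not (v ≟ᵇ u)))
count-remove f {u} fu =
  trans (count-split f (_≟ᵇ u)) (cong (_+ count (λ v → f v ∧ not (v ≟ᵇ u))) only-u)
  where
  only-u : count (λ v → f v ∧ (v ≟ᵇ u)) ≡ 1
  only-u = ≤-antisym (count≤1 _ u λ v t → ≟ᵇ⇒≡ v u (∧-elimʳ {f v} t))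
    (≤-trans (≤-reflexive (sym (count-≟ᵇ u)))
             (count-mono (_≟ᵇ u) _ λ v t → subst (λ w → T (f w ∧ (w ≟ᵇ u))) (sym (≟ᵇ⇒≡ v u t))
                                                 (∧-intro fu (≟ᵇ-refl u))))

count≤1+count-remove : ∀ {n} (f : Fin n → Bool) u → count f ≤ suc (count (λ v → f v ∧ not (v ≟ᵇ u)))
count≤1+count-remove f u = begin
  count f
    ≡⟨ count-split f (_≟ᵇ u) ⟩
  count (λ v → f v ∧ (v ≟ᵇ u)) + count (λ v → f v ∧ not (v ≟ᵇ u))
    ≤⟨ +-monoˡ-≤ _ (count≤1 _ u λ v t → ≟ᵇ⇒≡ v u (∧-elimʳ {f v} t)) ⟩
  suc (count (λ v → f v ∧ not (v ≟ᵇ u))) ∎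
  where open ≤-Reasoning

≢⇒not-≟ᵇ : ∀ {n} {u v : Fin n} → u ≢ v → T (not (u ≟ᵇ v))
≢⇒not-≟ᵇ {u = u} {v} u≢v = fromWitnessFalse {a? = u Fin.≟ v} u≢v

count≥1 : ∀ {n} (f : Fin n → Bool) {u} → T (f u) → 1 ≤ count f
count≥1 f fu = subst (1 ≤_) (sym (count-remove f fu)) (s≤s z≤n)

count≥2 : ∀ {n} (f : Fin n → Bool) {u v} → T (f u) → T (f v) → u ≢ v → 2 ≤ count f
count≥2 f {u} {v} fu fv u≢v rewrite count-remove f fu =
  s≤s (count≥1 (λ w → f w ∧ not (w ≟ᵇ u)) (∧-intro fv (≢⇒not-≟ᵇ (u≢v ∘ sym))))

count≤1⇒unique : ∀ {n} (f : Fin n → Bool) → count f ≤ 1 → ∀ {u v} → T (f u) → T (f v) → u ≡ v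
count≤1⇒unique f c≤1 {u} {v} fu fv with u Fin.≟ v
... | yes u≡v = u≡v
... | no u≢v = ⊥-elim (<⇒≱ (count≥2 f fu fv u≢v) c≤1)

count-<-mono : ∀ {n} (f g : Fin n → Bool) → (∀ v → T (f v) → T (g v)) →
  ∀ x → T (g x) → ¬ T (f x) → count f < count g
count-<-mono f g f⊆g x gx ¬fx rewrite count-remove g gx =
  s≤s (count-mono f _ λ v fv → ∧-intro (f⊆g v fv) (≢⇒not-≟ᵇ λ { refl → ¬fx fv }))

count≥-onto : ∀ {n} (f : Fin n → Bool) (h : Fin n → ℕ) L →
  (∀ t → t < L → ∃ λ v → T (f v) × h v ≡ t) → L ≤ count f
count≥-onto f h zero onto = z≤n
count≥-onto f h (suc L) onto with onto L ≤-refl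
... | v₀ , fv₀ , hv₀ rewrite count-remove f fv₀ =
  s≤s (count≥-onto _ h L λ t t<L → case onto t (m≤n⇒m≤1+n t<L) of λ where
    (v , fv , hv) → v , ∧-intro fv (≢⇒not-≟ᵇ λ { refl → <-irrefl (trans (sym hv) hv₀) t<L }) , hv)

count≤-injective : ∀ {n} (f : Fin n → Bool) (h : Fin n → ℕ) L →
  (∀ v → T (f v) → h v < L) → (∀ {u v} → T (f u) → T (f v) → h u ≡ h v → u ≡ v) → count f ≤ L
count≤-injective f h zero bound inj = ≤-reflexive (count-none f λ v fv → n≮0 (bound v fv))
count≤-injective f h (suc L) bound inj
  with Fin.any? (λ v → T? (f v ∧ (h v ≡ᵇ L)))
... | yes (v₀ , t) rewrite count-remove f (∧-elimˡ {f v₀} t) =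
  s≤s (count≤-injective _ h L
    (λ v t′ → ≤∧≢⇒< (≤-pred (bound v (∧-elimˡ {f v} t′)))
                     (λ hv≡L → not-elim (∧-elimʳ {f v} t′)
                       (subst (λ w → T (v ≟ᵇ w))
                              (inj (∧-elimˡ {f v} t′) (∧-elimˡ {f v₀} t) (trans hv≡L hv₀≡L))
                              (≟ᵇ-refl v))))
    (λ fu fv → inj (∧-elimˡ fu) (∧-elimˡ fv)))
  where hv₀≡L = sym (≡ᵇ⇒≡ (h v₀) L (∧-elimʳ {f v₀} t))
... | no ¬hit = m≤n⇒m≤1+n (count≤-injective f h L
    (λ v fv → ≤∧≢⇒< (≤-pred (bound v fv)) λ hv≡L → ¬hit (v , ∧-intro fv (≡⇒≡ᵇ (h v) L hv≡L)))
    inj)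

countRange : (ℕ → Bool) → ℕ → ℕ → ℕ
countRange f i zero = 0
countRange f i (suc l) = boolToℕ (f i) + countRange f (suc i) l

InRange : ℕ → ℕ → ℕ → Set
InRange i l p = i ≤ p × p < i + l

InRange-head : ∀ {i l} → InRange i (suc l) i
InRange-head {i} {l} = ≤-refl , m<m+n i z<s

InRange-tail : ∀ {i l p} → InRange (suc i) l p → InRange i (suc l) p
InRange-tail {i} {l} (i<p , p<) = <⇒≤ i<p , ≤-trans p< (≤-reflexive (sym (+-suc i l)))

countRange-cong : ∀ {f g} i l → (∀ p → InRange i l p → f p ≡ g p) → countRange f i l ≡ countRange g i l
countRange-cong i zero e = refl
countRange-cong i (suc l) e =
  cong₂ _+_ (cong boolToℕ (e i InRange-head)) (countRange-cong (suc i) l λ p r → e p (InRange-tail r))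

countRange-++ : ∀ f i l₁ l₂ → countRange f i (l₁ + l₂) ≡ countRange f i l₁ + countRange f (i + l₁) l₂
countRange-++ f i zero l₂ = cong (λ j → countRange f j l₂) (sym (+-identityʳ i))
countRange-++ f i (suc l₁) l₂ = begin
  boolToℕ (f i) + countRange f (suc i) (l₁ + l₂)
    ≡⟨ cong (boolToℕ (f i) +_) (countRange-++ f (suc i) l₁ l₂) ⟩
  boolToℕ (f i) + (countRange f (suc i) l₁ + countRange f (suc i + l₁) l₂)
    ≡⟨ sym (+-assoc (boolToℕ (f i)) _ _) ⟩
  countRange f i (suc l₁) + countRange f (suc i + l₁) l₂
    ≡⟨ cong (λ j → countRange f i (suc l₁) + countRange f j l₂) (sym (+-suc i l₁)) ⟩
  countRange f i (suc l₁) + countRange f (i + suc l₁) l₂ ∎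
  where open ≡-Reasoning

countRange≤length : ∀ f i l → countRange f i l ≤ l
countRange≤length f i zero = z≤n
countRange≤length f i (suc l) = +-mono-≤ (boolToℕ≤1 (f i)) (countRange≤length f (suc i) l)

countRange-none : ∀ f i l → (∀ p → InRange i l p → ¬ T (f p)) → countRange f i l ≡ 0
countRange-none f i zero h = refl
countRange-none f i (suc l) h with f i in e
... | true = ⊥-elim (h i InRange-head (subst T (sym e) tt))
... | false = countRange-none f (suc i) l λ p r → h p (InRange-tail r)

countRange-all : ∀ f i l → (∀ p → InRange i l p → T (f p)) → countRange f i l ≡ l
countRange-all f i zero h = refl
countRange-all f i (suc l) h with f i in e
... | false = ⊥-elim (subst T e (h i InRange-head))
... | true = cong suc (countRange-all f (suc i) l λ p r → h p (InRange-tail r))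

countRange-∨ : ∀ f g i l → (∀ p → InRange i l p → ¬ (T (f p) × T (g p))) →
  countRange (λ p → f p ∨ g p) i l ≡ countRange f i l + countRange g i l
countRange-∨ f g i zero h = refl
countRange-∨ f g i (suc l) h =
  trans (cong₂ _+_ (disjoint (f i) (g i) (h i InRange-head))
                   (countRange-∨ f g (suc i) l λ p r → h p (InRange-tail r)))
        (interchange (boolToℕ (f i)) (boolToℕ (g i)) _ _)
  where
  disjoint : ∀ a b → ¬ (T a × T b) → boolToℕ (a ∨ b) ≡ boolToℕ a + boolToℕ b
  disjoint true true h = ⊥-elim (h (tt , tt))
  disjoint true false h = refl
  disjoint false b h = refl

countRange≤1 : ∀ f i l → (∀ {p q} → InRange i l p → InRange i l q → T (f p) → T (f q) → p ≡ q) →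
  countRange f i l ≤ 1
countRange≤1 f i zero h = z≤n
countRange≤1 f i (suc l) h with f i in e
... | true = ≤-reflexive (cong suc (countRange-none f (suc i) l λ p r fp →
               <-irrefl (h InRange-head (InRange-tail r) (subst T (sym e) tt) fp) (proj₁ r)))
... | false = countRange≤1 f (suc i) l λ rp rq → h (InRange-tail rp) (InRange-tail rq)

countRange-witness : ∀ f i l → 1 ≤ countRange f i l → ∃ λ p → InRange i l p × T (f p)
countRange-witness f i (suc l) h with f i in e
... | true = i , InRange-head , subst T (sym e) tt
... | false with countRange-witness f (suc i) l h
...   | p , r , fp = p , InRange-tail r , fp

countRange≥1 : ∀ f i l {p} → InRange i l p → T (f p) → 1 ≤ countRange f i l
countRange≥1 f i zero (i≤p , p<i+0) fp = ⊥-elim (<⇒≱ p<i+0 (≤-trans (≤-reflexive (+-identityʳ i)) i≤p))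
countRange≥1 f i (suc l) {p} (i≤p , p<) fp with i ≟ p
... | yes refl = ≤-trans (boolToℕ-mono {true} (λ _ → fp)) (m≤m+n _ _)
... | no i≢p =
  ≤-trans (countRange≥1 f (suc i) l (≤∧≢⇒< i≤p i≢p , ≤-trans p< (≤-reflexive (+-suc i l))) fp) (m≤n+m _ _)

countRange+countRange-not : ∀ f i l → countRange f i l + countRange (not ∘ f) i l ≡ l
countRange+countRange-not f i zero = refl
countRange+countRange-not f i (suc l) =
  trans (interchange (boolToℕ (f i)) _ (boolToℕ (not (f i))) _)
        (cong₂ _+_ (complement (f i)) (countRange+countRange-not f (suc i) l))
  where
  complement : ∀ b → boolToℕ b + boolToℕ (not b) ≡ 1
  complement true = refl
  complement false = refl

countRange≥run : ∀ f i l j q → i ≤ j → j + q ≤ i + l → (∀ t → t < q → T (f (j + t))) →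
  q ≤ countRange f i l
countRange≥run f i l j q i≤j j+q≤i+l run = begin
  q                                      ≡⟨ sym (countRange-all f j q inRun) ⟩
  countRange f j q                       ≤⟨ m≤n+m _ _ ⟩
  countRange f i (j ∸ i) + countRange f j q
    ≡⟨ cong (λ x → countRange f i (j ∸ i) + countRange f x q) (sym (m+[n∸m]≡n i≤j)) ⟩
  countRange f i (j ∸ i) + countRange f (i + (j ∸ i)) q
    ≡⟨ sym (countRange-++ f i (j ∸ i) q) ⟩
  countRange f i (j ∸ i + q)             ≤⟨ m≤m+n _ _ ⟩
  countRange f i (j ∸ i + q) + countRange f (i + (j ∸ i + q)) (l ∸ (j ∸ i + q))
    ≡⟨ sym (countRange-++ f i (j ∸ i + q) _) ⟩
  countRange f i (j ∸ i + q + (l ∸ (j ∸ i + q)))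
    ≡⟨ cong (countRange f i) (m+[n∸m]≡n run≤l) ⟩
  countRange f i l ∎
  where
  open ≤-Reasoning
  inRun : ∀ p → InRange j q p → T (f p)
  inRun p (j≤p , p<j+q) = subst (T ∘ f) (m+[n∸m]≡n j≤p)
    (run (p ∸ j) (subst (p ∸ j <_) (m+n∸m≡n j q) (∸-monoˡ-< p<j+q j≤p)))
  run≤l : j ∸ i + q ≤ l
  run≤l = +-cancelˡ-≤ i _ _ (begin
    i + (j ∸ i + q)   ≡⟨ sym (+-assoc i (j ∸ i) q) ⟩
    i + (j ∸ i) + q   ≡⟨ cong (_+ q) (m+[n∸m]≡n i≤j) ⟩
    j + q             ≤⟨ j+q≤i+l ⟩
    i + l ∎)

segment : (ℕ → Bool) → ℕ → ℕ → List Bool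
segment g i zero = []
segment g i (suc l) = g i ∷ segment g (suc i) l

length-segment : ∀ g i l → length (segment g i l) ≡ l
length-segment g i zero = refl
length-segment g i (suc l) = cong suc (length-segment g (suc i) l)

drop-segment : ∀ g i l j → j ≤ l → drop j (segment g i l) ≡ segment g (i + j) (l ∸ j)
drop-segment g i l zero _ = cong (λ x → segment g x l) (sym (+-identityʳ i))
drop-segment g i (suc l) (suc j) (s≤s j≤l) =
  trans (drop-segment g (suc i) l j j≤l) (cong (λ x → segment g x (l ∸ j)) (sym (+-suc i j)))

take-segment : ∀ g i l l′ → l′ ≤ l → take l′ (segment g i l) ≡ segment g i l′
take-segment g i l zero _ = refl
take-segment g i (suc l) (suc l′) (s≤s l′≤l) = cong (g i ∷_) (take-segment g (suc i) l l′ l′≤l)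

ones-segment : ∀ g i l → ones (segment g i l) ≡ countRange g i l
ones-segment g i zero = refl
ones-segment g i (suc l) with g i
... | true = cong suc (ones-segment g (suc i) l)
... | false = ones-segment g (suc i) l

lookup-segment : ∀ g i l (x : Fin (length (segment g i l))) → List.lookup (segment g i l) x ≡ g (i + toℕ x)
lookup-segment g i (suc l) zero = cong g (sym (+-identityʳ i))
lookup-segment g i (suc l) (suc x) = trans (lookup-segment g (suc i) l x) (cong g (sym (+-suc i (toℕ x))))

module _ {P : ℕ → Set} (P? : Decidable P) where

  least : ∀ j → (∃ λ i → i ≤ j × P i) → ∃ λ i → i ≤ j × P i × (∀ {i′} → i′ < i → ¬ P i′)
  least zero (i , i≤0 , pi) = 0 , z≤n , subst P (n≤0⇒n≡0 i≤0) pi , λ ()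
  least (suc j) (i , i≤1+j , pi) with anyUpTo? P? (suc j)
  ... | yes (i′ , i′<1+j , pi′) with least j (i′ , ≤-pred i′<1+j , pi′)
  ...   | l , l≤j , pl , minimal = l , m≤n⇒m≤1+n l≤j , pl , minimal
  least (suc j) (i , i≤1+j , pi) | no none =
    suc j , ≤-refl , subst P (≤-antisym i≤1+j (≮⇒≥ λ i<1+j → none (i , i<1+j , pi))) pi ,
    λ i′<1+j pi′ → none (_ , i′<1+j , pi′)

  greatest : ∀ j → (∃ λ i → i ≤ j × P i) →
    ∃ λ g → g ≤ j × P g × (∀ {i} → g < i → i ≤ j → ¬ P i)
  greatest j (i , i≤j , pi) with P? j
  ... | yes pj = j , ≤-refl , pj , λ j<i i≤j _ → <⇒≱ j<i i≤j
  greatest zero (i , i≤0 , pi) | no ¬p0 = ⊥-elim (¬p0 (subst P (n≤0⇒n≡0 i≤0) pi))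
  greatest (suc j) (i , i≤1+j , pi) | no ¬pj with i ≟ suc j
  ... | yes refl = ⊥-elim (¬pj pi)
  ... | no i≢1+j with greatest j (i , ≤-pred (≤∧≢⇒< i≤1+j i≢1+j) , pi)
  ...   | g , g≤j , pg , maximal =
    g , m≤n⇒m≤1+n g≤j , pg , λ {i′} g<i′ i′≤1+j → case i′ ≟ suc j of λ where
      (yes refl) → ¬pj
      (no i′≢1+j) → maximal g<i′ (≤-pred (≤∧≢⇒< i′≤1+j i′≢1+j))

module _ {n : ℕ} (default : Fin n) where

  lookupOr : List (Fin n) → ℕ → Fin n
  lookupOr [] j = default
  lookupOr (x ∷ xs) zero = x
  lookupOr (x ∷ xs) (suc j) = lookupOr xs j

  indexOf : Fin n → List (Fin n) → ℕ
  indexOf v [] = 0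
  indexOf v (x ∷ xs) = if v ≟ᵇ x then 0 else suc (indexOf v xs)

  lookupOr-∈ : ∀ xs j → j < length xs → lookupOr xs j ∈ₗ xs
  lookupOr-∈ (x ∷ xs) zero _ = here refl
  lookupOr-∈ (x ∷ xs) (suc j) (s≤s j<) = there (lookupOr-∈ xs j j<)

  indexOf-∈ : ∀ {v} xs → v ∈ₗ xs → indexOf v xs < length xs × lookupOr xs (indexOf v xs) ≡ v
  indexOf-∈ {v} (x ∷ xs) v∈ with v Fin.≟ x | v∈
  ... | yes v≡x | _ = s≤s z≤n , sym v≡x
  ... | no v≢x | here v≡x = ⊥-elim (v≢x v≡x)
  ... | no v≢x | there v∈xs with indexOf-∈ xs v∈xs
  ...   | i< , lookup≡v = s≤s i< , lookup≡v

  indexOf-lookupOr : ∀ xs j → Unique xs → j < length xs → indexOf (lookupOr xs j) xs ≡ j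
  indexOf-lookupOr (x ∷ xs) zero _ _ with x Fin.≟ x
  ... | yes _ = refl
  ... | no x≢x = ⊥-elim (x≢x refl)
  indexOf-lookupOr (x ∷ xs) (suc j) (x∉xs ∷ unique) (s≤s j<) with lookupOr xs j Fin.≟ x
  ... | yes y≡x = ⊥-elim (All.lookup x∉xs (lookupOr-∈ xs j j<) (sym y≡x))
  ... | no _ = cong suc (indexOf-lookupOr xs j unique j<)

  lookupOr-toℕ : ∀ xs (i : Fin (length xs)) → lookupOr xs (toℕ i) ≡ List.lookup xs i
  lookupOr-toℕ (x ∷ xs) zero = refl
  lookupOr-toℕ (x ∷ xs) (suc i) = lookupOr-toℕ xs i

  Linked-lookupOr : ∀ {ℓ} {R : Fin n → Fin n → Set ℓ} xs → Linked R xs →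
    ∀ j → suc j < length xs → R (lookupOr xs j) (lookupOr xs (suc j))
  Linked-lookupOr (x ∷ y ∷ xs) (r ∷ _) zero _ = r
  Linked-lookupOr (x ∷ y ∷ xs) (_ ∷ rs) (suc j) (s≤s j<) = Linked-lookupOr (y ∷ xs) rs j j<
  Linked-lookupOr (x ∷ []) [-] j (s≤s ())

maxUpTo : (ℕ → ℕ) → ℕ → ℕ
maxUpTo f zero = f zero
maxUpTo f (suc t) = f (suc t) ⊔ maxUpTo f t

maxUpTo-upper : ∀ f {t a} → a ≤ t → f a ≤ maxUpTo f t
maxUpTo-upper f {zero} z≤n = ≤-refl
maxUpTo-upper f {suc t} a≤1+t with m≤n⇒m<n∨m≡n a≤1+t
... | inj₂ refl = m≤m⊔n _ _
... | inj₁ a<1+t = ≤-trans (maxUpTo-upper f (≤-pred a<1+t)) (m≤n⊔m _ _)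

maxUpTo-attained : ∀ f t → ∃ λ a → a ≤ t × maxUpTo f t ≡ f a
maxUpTo-attained f zero = zero , z≤n , refl
maxUpTo-attained f (suc t) with ≤-total (f (suc t)) (maxUpTo f t) | maxUpTo-attained f t
... | inj₁ ≤max | a , a≤t , eq = a , m≤n⇒m≤1+n a≤t , trans (m≤n⇒m⊔n≡n ≤max) eq
... | inj₂ ≥max | _ = suc t , ≤-refl , m≥n⇒m⊔n≡m ≥max

-- Induced subtrees

module _ {n : ℕ} (G : Graph n) where
  open Graph G using (adj)

  Adj-sym : ∀ {u v} → Adj G u v → Adj G v u
  Adj-sym {u} {v} = subst T (Graph.sym G u v)

  Adj-irrefl : ∀ {v} → ¬ Adj G v v
  Adj-irrefl {v} = subst T (Graph.irrefl G v)

  ∈⇒T : ∀ {S : Subset n} {v} → v ∈ S → T (lookup S v)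
  ∈⇒T v∈S = subst T (sym ([]=⇒lookup v∈S)) tt

  T⇒∈ : ∀ {S : Subset n} {v} → T (lookup S v) → v ∈ S
  T⇒∈ {S} {v} t with lookup S v in eq
  ... | true = lookup⇒[]= v S eq

  ∈-tabulate⁺ : ∀ {f : Fin n → Bool} {v} → T (f v) → v ∈ tabulate f
  ∈-tabulate⁺ {f} {v} = T⇒∈ ∘ subst T (sym (lookup∘tabulate f v))

  ∈-tabulate⁻ : ∀ {f : Fin n → Bool} {v} → v ∈ tabulate f → T (f v)
  ∈-tabulate⁻ {f} {v} = subst T (lookup∘tabulate f v) ∘ ∈⇒T

  ∈-allVertices : ∀ v → v ∈ allVertices G
  ∈-allVertices v = ∈-tabulate⁺ tt

  ∣allVertices∣≡n : ∣ allVertices G ∣ ≡ n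
  ∣allVertices∣≡n = trans (∣tabulate∣≡count {n} (λ _ → true)) (count-all {n} (λ _ → true) (λ _ → tt))

  degIn≡count : ∀ S v → degIn G S v ≡ count (λ w → lookup S w ∧ adj v w)
  degIn≡count S v = ∣tabulate∣≡count (λ w → lookup S w ∧ adj v w)

  leavesIn≡count : ∀ S → leavesIn G S ≡ count (λ v → lookup S v ∧ (degIn G S v ≡ᵇ 1))
  leavesIn≡count S = ∣tabulate∣≡count (λ v → lookup S v ∧ (degIn G S v ≡ᵇ 1))

  WalkIn-source : ∀ {S u v} → WalkIn G S u v → u ∈ S
  WalkIn-source (here u∈S) = u∈S
  WalkIn-source (step u∈S _ _) = u∈S

  WalkIn-++ : ∀ {S u v w} → WalkIn G S u v → WalkIn G S v w → WalkIn G S u w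
  WalkIn-++ (here _) q = q
  WalkIn-++ (step u∈S a p) q = step u∈S a (WalkIn-++ p q)

  WalkIn-reverse : ∀ {S u v} → WalkIn G S u v → WalkIn G S v u
  WalkIn-reverse p = go p (here (WalkIn-source p))
    where
    go : ∀ {S u v w} → WalkIn G S u v → WalkIn G S u w → WalkIn G S v w
    go (here _) acc = acc
    go (step _ a p) acc = go p (step (WalkIn-source p) (Adj-sym a) acc)

  subtree-acyclic : IsTree G → ∀ S → ¬ CycleIn G S
  subtree-acyclic (_ , acyclic) S (v₀ , rest , 2≤ , inS , unique , linked) =
    acyclic (v₀ , rest , 2≤ , all-in inS , unique , linked)
    where
    all-in : ∀ {xs : List (Fin n)} → All (_∈ S) xs → All (_∈ allVertices G) xs
    all-in [] = []
    all-in (_ ∷ ps) = ∈-allVertices _ ∷ all-in ps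

  private
    neighbourT : ∀ {S v w} → w ∈ S → Adj G v w → T (lookup S w ∧ adj v w)
    neighbourT w∈S a = ∧-intro (∈⇒T w∈S) a

  degIn≤1⇒unique : ∀ {S v w w′} → degIn G S v ≤ 1 →
    w ∈ S → Adj G v w → w′ ∈ S → Adj G v w′ → w ≡ w′
  degIn≤1⇒unique {S} {v} d≤1 w∈S a w′∈S a′ =
    count≤1⇒unique _ (subst (_≤ 1) (degIn≡count S v) d≤1) (neighbourT w∈S a) (neighbourT w′∈S a′)

  degIn≥2 : ∀ {S v w w′} → w ∈ S → Adj G v w → w′ ∈ S → Adj G v w′ → w ≢ w′ → 2 ≤ degIn G S v
  degIn≥2 {S} {v} w∈S a w′∈S a′ w≢w′ =
    subst (2 ≤_) (sym (degIn≡count S v)) (count≥2 _ (neighbourT w∈S a) (neighbourT w′∈S a′) w≢w′)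

  degIn≥1 : ∀ {S v w} → w ∈ S → Adj G v w → 1 ≤ degIn G S v
  degIn≥1 {S} {v} w∈S a =
    subst (1 ≤_) (sym (degIn≡count S v)) (count≥1 (λ x → lookup S x ∧ adj v x) (neighbourT w∈S a))

  degIn-mono : ∀ {S S′} → (∀ {x} → x ∈ S → x ∈ S′) → ∀ v → degIn G S v ≤ degIn G S′ v
  degIn-mono {S} {S′} S⊆S′ v rewrite degIn≡count S v | degIn≡count S′ v =
    count-mono _ _ λ w t → ∧-intro (∈⇒T (S⊆S′ (T⇒∈ (∧-elimˡ {lookup S w} t)))) (∧-elimʳ {lookup S w} t)

  neighbour : ∀ {S v} → 1 ≤ degIn G S v → ∃ λ w → w ∈ S × Adj G v w
  neighbour {S} {v} d≥1 with count-witness _ (subst (1 ≤_) (degIn≡count S v) d≥1)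
  ... | w , t = w , T⇒∈ (∧-elimˡ {lookup S w} t) , ∧-elimʳ {lookup S w} t

  degIn≥2⇒neighbour≢ : ∀ {S x} → 2 ≤ degIn G S x → ∀ y → ∃ λ w → w ∈ S × Adj G x w × w ≢ y
  degIn≥2⇒neighbour≢ {S} {x} d≥2 y
    with count-witness (λ w → (lookup S w ∧ adj x w) ∧ not (w ≟ᵇ y)) (≤-pred (begin
    2                                             ≤⟨ subst (2 ≤_) (degIn≡count S x) d≥2 ⟩
    count (λ w → lookup S w ∧ adj x w)            ≤⟨ count≤1+count-remove _ y ⟩
    suc (count (λ w → (lookup S w ∧ adj x w) ∧ not (w ≟ᵇ y))) ∎))
    where open ≤-Reasoning
  ... | w , t = let t′ = ∧-elimˡ {lookup S w ∧ adj x w} t in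
    w , T⇒∈ (∧-elimˡ {lookup S w} t′) , ∧-elimʳ {lookup S w} t′ ,
    λ { refl → not-elim (∧-elimʳ {lookup S w ∧ adj x w} t) (≟ᵇ-refl w) }

  ∣S∣≥2⇒other : ∀ {S v} → 2 ≤ ∣ S ∣ → v ∈ S → ∃ λ u → u ∈ S × u ≢ v
  ∣S∣≥2⇒other {S} {v} ∣S∣≥2 v∈S with count-witness (λ u → lookup S u ∧ not (u ≟ᵇ v))
    (≤-pred (≤-trans ∣S∣≥2 (≤-reflexive (trans (∣p∣≡count S) (count-remove (lookup S) (∈⇒T v∈S))))))
  ... | u , t = u , T⇒∈ (∧-elimˡ {lookup S u} t) , λ { refl → not-elim (∧-elimʳ {lookup S u} t) (≟ᵇ-refl u) }

  connected⇒degIn≥1 : ∀ {S u v} → ConnectedIn G S → u ∈ S → v ∈ S → u ≢ v → 1 ≤ degIn G S u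
  connected⇒degIn≥1 conn u∈S v∈S u≢v with conn _ _ u∈S v∈S
  ... | here _ = ⊥-elim (u≢v refl)
  ... | step _ a p = degIn≥1 (WalkIn-source p) a

  -- Two adjacent leaves of a connected S form a component, hence all of S.
  adjacent-leaves⇒∣S∣≤2 : ∀ {S x y} → ConnectedIn G S → x ∈ S → y ∈ S →
    degIn G S x ≡ 1 → degIn G S y ≡ 1 → Adj G x y → ∣ S ∣ ≤ 2
  adjacent-leaves⇒∣S∣≤2 {S} {x} {y} conn x∈S y∈S dx dy a = begin
    ∣ S ∣
      ≡⟨ ∣p∣≡count S ⟩
    count (lookup S)
      ≤⟨ count-mono _ _ (λ z t → in-pair (reach (conn x z x∈S (T⇒∈ t)) (inj₁ refl))) ⟩
    count (λ v → (v ≟ᵇ x) ∨ (v ≟ᵇ y))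
      ≤⟨ m≤m+n _ _ ⟩
    count (λ v → (v ≟ᵇ x) ∨ (v ≟ᵇ y)) + count (λ v → (v ≟ᵇ x) ∧ (v ≟ᵇ y))
      ≡⟨ count-∨+count-∧ (_≟ᵇ x) (_≟ᵇ y) ⟩
    count (_≟ᵇ x) + count (_≟ᵇ y)
      ≡⟨ cong₂ _+_ (count-≟ᵇ x) (count-≟ᵇ y) ⟩
    2 ∎
    where
    open ≤-Reasoning
    reach : ∀ {c z} → WalkIn G S c z → c ≡ x ⊎ c ≡ y → z ≡ x ⊎ z ≡ y
    reach (here _) c∈xy = c∈xy
    reach (step _ a′ p) (inj₁ refl) =
      reach p (inj₂ (degIn≤1⇒unique (≤-reflexive dx) (WalkIn-source p) a′ y∈S a))
    reach (step _ a′ p) (inj₂ refl) =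
      reach p (inj₁ (degIn≤1⇒unique (≤-reflexive dy) (WalkIn-source p) a′ x∈S (Adj-sym a)))
    in-pair : ∀ {z} → z ≡ x ⊎ z ≡ y → T ((z ≟ᵇ x) ∨ (z ≟ᵇ y))
    in-pair {z} (inj₁ refl) = ∨-introˡ (≟ᵇ-refl z)
    in-pair {z} (inj₂ refl) = ∨-introʳ {z ≟ᵇ x} (≟ᵇ-refl z)

  delete : Fin n → Subset n → Subset n
  delete v S = tabulate (λ w → lookup S w ∧ not (w ≟ᵇ v))

  ∈-delete⁺ : ∀ {S v x} → x ∈ S → x ≢ v → x ∈ delete v S
  ∈-delete⁺ {S} x∈S x≢v = ∈-tabulate⁺ (∧-intro (∈⇒T {S} x∈S) (≢⇒not-≟ᵇ x≢v))

  ∈-delete⁻ : ∀ {S v x} → x ∈ delete v S → x ∈ S × x ≢ v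
  ∈-delete⁻ {S} {v} {x} x∈ = let t = ∈-tabulate⁻ x∈ in
    T⇒∈ {S} (∧-elimˡ {lookup S x} t) , λ { refl → not-elim (∧-elimʳ {lookup S x} t) (≟ᵇ-refl x) }

  module DeleteLeaf (S : Subset n) (conn : ConnectedIn G S) (∣S∣≥3 : 3 ≤ ∣ S ∣)
                    {v} (v∈S : v ∈ S) (dv : degIn G S v ≡ 1) where

    private
      u : Fin n
      u = proj₁ (neighbour {S} (≤-reflexive (sym dv)))
      u∈S : u ∈ S
      u∈S = proj₁ (proj₂ (neighbour {S} (≤-reflexive (sym dv))))
      v~u : Adj G v u
      v~u = proj₂ (proj₂ (neighbour {S} (≤-reflexive (sym dv))))

      only-neighbour : ∀ {x} → x ∈ S → Adj G x v → x ≡ u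
      only-neighbour x∈S a = degIn≤1⇒unique (≤-reflexive dv) x∈S (Adj-sym a) u∈S v~u

      avoid : ∀ {x y} → WalkIn G S x y → x ≢ v → y ≢ v → WalkIn G (delete v S) x y
      avoid (here x∈S) x≢v _ = here (∈-delete⁺ x∈S x≢v)
      avoid (step {w = w} x∈S a p) x≢v y≢v with w Fin.≟ v
      ... | no w≢v = step (∈-delete⁺ x∈S x≢v) a (avoid p w≢v y≢v)
      avoid (step x∈S a (here _)) x≢v y≢v | yes refl = ⊥-elim (y≢v refl)
      avoid {x} {y} (step x∈S a (step _ a′ p)) x≢v y≢v | yes refl =
        subst (λ z → WalkIn G (delete v S) z y) (sym x≡w′) (avoid p (x≢v ∘ trans x≡w′) y≢v)
        where
        -- a walk can only pass through the leaf v by going back to its neighbour u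
        x≡w′ = trans (only-neighbour x∈S a) (sym (only-neighbour (WalkIn-source p) (Adj-sym a′)))

      u-not-leaf : degIn G S u ≢ 1
      u-not-leaf du = <⇒≱ ∣S∣≥3 (adjacent-leaves⇒∣S∣≤2 conn v∈S u∈S dv du v~u)

      degIn-delete : ∀ {w} → w ∈ S → degIn G S w ≡ 1 → w ≢ v → degIn G (delete v S) w ≡ degIn G S w
      degIn-delete {w} w∈S dw w≢v =
        trans (degIn≡count (delete v S) w) (trans (count-cong same) (sym (degIn≡count S w)))
        where
        same : ∀ x → (lookup (delete v S) x ∧ adj w x) ≡ (lookup S x ∧ adj w x)
        same x rewrite lookup∘tabulate (λ y → lookup S y ∧ not (y ≟ᵇ v)) x with x Fin.≟ v
        ... | no x≢v rewrite ∧-identityʳ (lookup S x) = refl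
        ... | yes refl with adj w x in w~x
        ...   | false = trans (∧-zeroʳ _) (sym (∧-zeroʳ _))
        ...   | true = ⊥-elim (u-not-leaf (subst (λ z → degIn G S z ≡ 1)
                                                 (only-neighbour w∈S (subst T (sym w~x) tt)) dw))

    connected : ConnectedIn G (delete v S)
    connected x y x∈ y∈ = avoid (conn x y (proj₁ (∈-delete⁻ {S} x∈)) (proj₁ (∈-delete⁻ {S} y∈)))
                                (proj₂ (∈-delete⁻ {S} x∈)) (proj₂ (∈-delete⁻ {S} y∈))

    size : suc ∣ delete v S ∣ ≡ ∣ S ∣
    size = begin
      suc ∣ delete v S ∣
        ≡⟨ cong suc (∣tabulate∣≡count (λ w → lookup S w ∧ not (w ≟ᵇ v))) ⟩
      suc (count (λ w → lookup S w ∧ not (w ≟ᵇ v)))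
        ≡⟨ sym (count-remove (lookup S) (∈⇒T v∈S)) ⟩
      count (lookup S)
        ≡⟨ sym (∣p∣≡count S) ⟩
      ∣ S ∣ ∎
      where open ≡-Reasoning

    -- Removing a leaf of a tree with at least three vertices makes no other vertex a leaf
    -- and keeps every other leaf, so at most one leaf is lost.
    leaves : leavesIn G S ≤ suc (leavesIn G (delete v S))
    leaves = begin
      leavesIn G S
        ≡⟨ leavesIn≡count S ⟩
      count isLeaf
        ≡⟨ count-remove isLeaf (∧-intro (∈⇒T v∈S) (≡⇒≡ᵇ _ _ dv)) ⟩
      suc (count (λ w → isLeaf w ∧ not (w ≟ᵇ v)))
        ≤⟨ s≤s (count-mono _ _ still-leaf) ⟩
      suc (count (λ w → lookup (delete v S) w ∧ (degIn G (delete v S) w ≡ᵇ 1)))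
        ≡⟨ cong suc (sym (leavesIn≡count (delete v S))) ⟩
      suc (leavesIn G (delete v S)) ∎
      where
      open ≤-Reasoning
      isLeaf : Fin n → Bool
      isLeaf w = lookup S w ∧ (degIn G S w ≡ᵇ 1)
      still-leaf : ∀ w → T (isLeaf w ∧ not (w ≟ᵇ v)) →
        T (lookup (delete v S) w ∧ (degIn G (delete v S) w ≡ᵇ 1))
      still-leaf w t =
        let leaf = ∧-elimˡ {isLeaf w} t
            w∈S = T⇒∈ {S} (∧-elimˡ {lookup S w} leaf)
            dw = ≡ᵇ⇒≡ _ _ (∧-elimʳ {lookup S w} leaf)
            w≢v : w ≢ v
            w≢v = λ { refl → not-elim (∧-elimʳ {isLeaf w} t) (≟ᵇ-refl w) }
        in ∧-intro (∈⇒T (∈-delete⁺ {S} w∈S w≢v)) (≡⇒≡ᵇ _ _ (trans (degIn-delete w∈S dw w≢v) dw))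

  -- ∣ S ∣ ≤ leavesIn G S + m says that S has at most m non-leaves; pruning leaves one at a
  -- time never increases that number.
  pruneLeaves : IsTree G → ∀ j {t m} (S : Subset n) → ConnectedIn G S →
    ∣ S ∣ ≡ t + j → t + j ≤ leavesIn G S + m → m + 2 ≤ t →
    Σ (Subset n) λ S′ → InducesTree G S′ × ∣ S′ ∣ ≡ t × t ≤ leavesIn G S′ + m
  pruneLeaves tree zero {t} {m} S conn ∣S∣≡ t≤ _ =
    S , (conn , subtree-acyclic tree S) , trans ∣S∣≡ (+-identityʳ t) ,
    subst (_≤ leavesIn G S + m) (+-identityʳ t) t≤
  pruneLeaves tree (suc j) {t} {m} S conn ∣S∣≡ t≤ m+2≤t =
    pruneLeaves tree j (delete v S) (D.connected) size′ leaves′ m+2≤t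
    where
    open ≤-Reasoning
    t<∣S∣ : t < ∣ S ∣
    t<∣S∣ = subst (t <_) (trans (sym (+-suc t j)) (sym ∣S∣≡)) (s≤s (m≤m+n t j))
    ∣S∣≥3 : 3 ≤ ∣ S ∣
    ∣S∣≥3 = ≤-trans (s≤s (≤-trans (m≤n+m 2 m) m+2≤t)) t<∣S∣
    leaves≥1 : 1 ≤ leavesIn G S
    leaves≥1 = +-cancelʳ-≤ m 1 (leavesIn G S) (begin
      suc m              ≤⟨ ≤-trans (n≤1+n (suc m)) (≤-reflexive (+-comm 2 m)) ⟩
      m + 2              ≤⟨ m+2≤t ⟩
      t                  ≤⟨ m≤m+n t (suc j) ⟩
      t + suc j          ≤⟨ t≤ ⟩
      leavesIn G S + m ∎)
    leaf : ∃ λ v → T (lookup S v ∧ (degIn G S v ≡ᵇ 1))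
    leaf = count-witness _ (subst (1 ≤_) (leavesIn≡count S) leaves≥1)
    v = proj₁ leaf
    v∈S : v ∈ S
    v∈S = T⇒∈ {S} (∧-elimˡ {lookup S v} (proj₂ leaf))
    dv : degIn G S v ≡ 1
    dv = ≡ᵇ⇒≡ _ _ (∧-elimʳ {lookup S v} (proj₂ leaf))
    module D = DeleteLeaf S conn ∣S∣≥3 v∈S dv
    size′ : ∣ delete v S ∣ ≡ t + j
    size′ = suc-injective (trans D.size (trans ∣S∣≡ (+-suc t j)))
    leaves′ : t + j ≤ leavesIn G (delete v S) + m
    leaves′ = ≤-pred (begin
      suc (t + j)                          ≡⟨ sym (+-suc t j) ⟩
      t + suc j                            ≤⟨ t≤ ⟩
      leavesIn G S + m                     ≤⟨ +-monoˡ-≤ m D.leaves ⟩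
      suc (leavesIn G (delete v S) + m) ∎)

-- Window sizes and the leaf word

-- For a caterpillar with k spine vertices, M m is the largest number of vertices of an
-- induced subtree with m internal vertices.
module WindowSizes (n K : ℕ) (M : ℕ → ℕ) (M-1 : 3 ≤ M 1)
  (M-suc : ∀ {m} → 1 ≤ m → m < suc K → M m < M (suc m))
  (M-subadditive : ∀ {a b} → 1 ≤ a → 1 ≤ b → a + b ≤ suc K → M (a + b) + 2 ≤ M a + M b)
  (M-k : M (suc K) ≡ n) where

  k : ℕ
  k = suc K

  M-mono : ∀ {i j} → 1 ≤ i → i ≤ j → j ≤ k → M i ≤ M j
  M-mono {j = zero} (s≤s _) () _
  M-mono {j = suc j} 1≤i i≤1+j 1+j≤k with m≤n⇒m<n∨m≡n i≤1+j
  ... | inj₂ refl = ≤-refl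
  ... | inj₁ i<1+j = ≤-trans (M-mono 1≤i (≤-pred i<1+j) (<⇒≤ 1+j≤k))
                             (<⇒≤ (M-suc (≤-trans 1≤i (≤-pred i<1+j)) 1+j≤k))

  M-< : ∀ {i j} → 1 ≤ i → i < j → j ≤ k → M i < M j
  M-< 1≤i i<j j≤k = <-≤-trans (M-suc 1≤i (≤-trans i<j j≤k)) (M-mono (s≤s z≤n) i<j j≤k)

  M-injective : ∀ {i j} → 1 ≤ i → 1 ≤ j → i ≤ k → j ≤ k → M i ≡ M j → i ≡ j
  M-injective {i} {j} 1≤i 1≤j i≤k j≤k Mi≡Mj with <-cmp i j
  ... | tri< i<j _ _ = ⊥-elim (<-irrefl Mi≡Mj (M-< 1≤i i<j j≤k))
  ... | tri≈ _ i≡j _ = i≡j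
  ... | tri> _ _ j<i = ⊥-elim (<-irrefl (sym Mi≡Mj) (M-< 1≤j j<i i≤k))

  M-≥ : ∀ i → 1 ≤ i → i ≤ k → i + 2 ≤ M i
  M-≥ (suc zero) _ _ = M-1
  M-≥ (suc (suc i)) _ 2+i≤k =
    ≤-trans (s≤s (M-≥ (suc i) (s≤s z≤n) (<⇒≤ 2+i≤k))) (M-suc (s≤s z≤n) 2+i≤k)

  n≥3 : 3 ≤ n
  n≥3 = ≤-trans M-1 (≤-trans (M-mono ≤-refl (s≤s z≤n) ≤-refl) (≤-reflexive M-k))

  below-top : ∀ {m} → m ≤ k → M m < n → m < k
  below-top {m} m≤k Mm<n = ≤∧≢⇒< m≤k λ { refl → <-irrefl M-k Mm<n }

  -- m is the least number of internal vertices of an induced subtree with s vertices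
  IsLeastCover : ℕ → ℕ → Set
  IsLeastCover s m = 1 ≤ m × m ≤ k × s ≤ M m × (∀ {m′} → 1 ≤ m′ → m′ < m → M m′ < s)

  leastCover : ∀ {s} → s ≤ n → ∃ (IsLeastCover s)
  leastCover {s} s≤n
    with least (λ m → (1 ≤? m) ×-dec (s ≤? M m)) k (k , ≤-refl , s≤s z≤n , subst (s ≤_) (sym M-k) s≤n)
  ... | m , m≤k , (1≤m , s≤Mm) , minimal =
    m , 1≤m , m≤k , s≤Mm , λ 1≤m′ m′<m → ≰⇒> λ s≤Mm′ → minimal m′<m (1≤m′ , s≤Mm′)

  leastCover-minimal : ∀ {s m L} → IsLeastCover s m → 1 ≤ L → s ≤ M L → m ≤ L
  leastCover-minimal (_ , _ , _ , minimal) 1≤L s≤ML = ≮⇒≥ λ L<m → <⇒≱ (minimal 1≤L L<m) s≤ML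

  leastCover-unique : ∀ {s m m′} → IsLeastCover s m → IsLeastCover s m′ → m ≡ m′
  leastCover-unique c@(1≤m , _ , s≤Mm , _) c′@(1≤m′ , _ , s≤Mm′ , _) =
    ≤-antisym (leastCover-minimal c 1≤m′ s≤Mm′) (leastCover-minimal c′ 1≤m s≤Mm)

  leastCover+2≤ : ∀ {s m} → 3 ≤ s → IsLeastCover s m → m + 2 ≤ s
  leastCover+2≤ {m = suc zero} 3≤s _ = 3≤s
  leastCover+2≤ {m = suc (suc m)} _ (_ , m≤k , _ , minimal) =
    ≤-trans (s≤s (M-≥ (suc m) (s≤s z≤n) (<⇒≤ m≤k))) (minimal (s≤s z≤n) ≤-refl)

  valueIn : ℕ → ℕ → ℕ → Bool
  valueIn c l m = (c ≤ᵇ M m) ∧ (M m <ᵇ c + l)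

  valueIn⁺ : ∀ {c l m} → c ≤ M m → M m < c + l → T (valueIn c l m)
  valueIn⁺ c≤ <c+l = ∧-intro (≤⇒≤ᵇ c≤) (<⇒<ᵇ <c+l)

  valueIn⁻ : ∀ c l m → T (valueIn c l m) → c ≤ M m × M m < c + l
  valueIn⁻ c l m t =
    ≤ᵇ⇒≤ c (M m) (∧-elimˡ {c ≤ᵇ M m} t) , <ᵇ⇒< (M m) (c + l) (∧-elimʳ {c ≤ᵇ M m} t)

  #values : ℕ → ℕ → ℕ
  #values c l = countRange (valueIn c l) 1 K

  #values-+ : ∀ c l₁ l₂ → #values c (l₁ + l₂) ≡ #values c l₁ + #values (c + l₁) l₂
  #values-+ c l₁ l₂ = trans (countRange-cong 1 K λ m _ → T-ext split join)
                            (countRange-∨ (valueIn c l₁) (valueIn (c + l₁) l₂) 1 K disjoint)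
    where
    split : ∀ {m} → T (valueIn c (l₁ + l₂) m) → T (valueIn c l₁ m ∨ valueIn (c + l₁) l₂ m)
    split {m} t with valueIn⁻ c (l₁ + l₂) m t | M m <? c + l₁
    ... | c≤ , Mm< | yes <c+l₁ = ∨-introˡ (valueIn⁺ c≤ <c+l₁)
    ... | c≤ , Mm< | no ≮c+l₁ =
      ∨-introʳ {valueIn c l₁ m} (valueIn⁺ (≮⇒≥ ≮c+l₁) (subst (M m <_) (sym (+-assoc c l₁ l₂)) Mm<))
    join : ∀ {m} → T (valueIn c l₁ m ∨ valueIn (c + l₁) l₂ m) → T (valueIn c (l₁ + l₂) m)
    join {m} t with ∨-elim {valueIn c l₁ m} t
    ... | inj₁ t₁ = let c≤ , Mm< = valueIn⁻ c l₁ m t₁ in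
                    valueIn⁺ c≤ (<-≤-trans Mm< (+-monoʳ-≤ c (m≤m+n l₁ l₂)))
    ... | inj₂ t₂ = let c+l₁≤ , Mm< = valueIn⁻ (c + l₁) l₂ m t₂ in
                    valueIn⁺ (≤-trans (m≤m+n c l₁) c+l₁≤) (subst (M m <_) (+-assoc c l₁ l₂) Mm<)
    disjoint : ∀ m → InRange 1 K m → ¬ (T (valueIn c l₁ m) × T (valueIn (c + l₁) l₂ m))
    disjoint m _ (t₁ , t₂) = <⇒≱ (proj₂ (valueIn⁻ c l₁ m t₁)) (proj₁ (valueIn⁻ (c + l₁) l₂ m t₂))

  valueIn-singleton : ∀ v m → T (valueIn v 1 m) → M m ≡ v
  valueIn-singleton v m t = let v≤ , Mm< = valueIn⁻ v 1 m t in
    ≤-antisym (≤-pred (subst (M m <_) (+-comm v 1) Mm<)) v≤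

  #values-singleton≤1 : ∀ v → #values v 1 ≤ 1
  #values-singleton≤1 v = countRange≤1 (valueIn v 1) 1 K λ {p} {q} (1≤p , p<k) (1≤q , q<k) tp tq →
    M-injective 1≤p 1≤q (<⇒≤ p<k) (<⇒≤ q<k)
                (trans (valueIn-singleton v p tp) (sym (valueIn-singleton v q tq)))

  letter : ℕ → Bool
  letter p = #values (p + 3) 1 ≡ᵇ 0

  ¬letter⇒value : ∀ {p} → T (not (letter p)) → ∃ λ m → (1 ≤ m × m < k) × M m ≡ p + 3
  ¬letter⇒value {p} t with #values (p + 3) 1 in eq
  ... | zero = ⊥-elim (not-elim t tt)
  ... | suc _ with countRange-witness (valueIn (p + 3) 1) 1 K (subst (1 ≤_) (sym eq) (s≤s z≤n))
  ...   | m , in-range , t′ = m , in-range , valueIn-singleton (p + 3) m t′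

  letter⇒¬value : ∀ {p m} → T (letter p) → 1 ≤ m → m < k → M m ≢ p + 3
  letter⇒¬value {p} t 1≤m m<k Mm≡ =
    <⇒≱ (countRange≥1 (valueIn (p + 3) 1) 1 K (1≤m , m<k) (valueIn⁺ (≤-reflexive (sym Mm≡)) hit))
        (≤-reflexive (≡ᵇ⇒≡ (#values (p + 3) 1) 0 t))
    where hit = subst (_< p + 3 + 1) (sym Mm≡) (m<m+n (p + 3) z<s)

  boolToℕ-not-letter : ∀ p → boolToℕ (not (letter p)) ≡ #values (p + 3) 1
  boolToℕ-not-letter p with #values (p + 3) 1 | #values-singleton≤1 (p + 3)
  ... | zero | _ = refl
  ... | suc zero | _ = refl
  ... | suc (suc _) | s≤s ()

  zeros≡#values : ∀ i l → countRange (not ∘ letter) i l ≡ #values (i + 3) l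
  zeros≡#values i zero = sym (countRange-none (valueIn (i + 3) 0) 1 K λ m _ t →
    let c≤ , Mm< = valueIn⁻ (i + 3) 0 m t in <⇒≱ Mm< (≤-trans (≤-reflexive (+-identityʳ (i + 3))) c≤))
  zeros≡#values i (suc l) = begin
    boolToℕ (not (letter i)) + countRange (not ∘ letter) (suc i) l
      ≡⟨ cong₂ _+_ (boolToℕ-not-letter i) (zeros≡#values (suc i) l) ⟩
    #values (i + 3) 1 + #values (suc i + 3) l
      ≡⟨ cong (λ c → #values (i + 3) 1 + #values c l) (+-comm 1 (i + 3)) ⟩
    #values (i + 3) 1 + #values (i + 3 + 1) l
      ≡⟨ sym (#values-+ (i + 3) 1 l) ⟩
    #values (i + 3) (suc l) ∎
    where open ≡-Reasoning

  letter-step : ∀ {x m m′} → x + 3 < n → IsLeastCover (x + 3) m → IsLeastCover (x + 4) m′ →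
    (x + 4) ∸ m′ ≡ (x + 3) ∸ m + (if letter x then 1 else 0)
  letter-step {x} {m} {m′} x+3<n cover cover′ with letter x in eq
  ... | false with ¬letter⇒value {x} (subst (T ∘ not) (sym eq) tt)
  ...   | m″ , (1≤m″ , m″<k) , Mm″≡x+3 = begin
    (x + 4) ∸ m′          ≡⟨ cong₂ _∸_ (+-suc x 3) (leastCover-unique cover′ cover-next) ⟩
    suc (x + 3) ∸ suc m″  ≡⟨ cong ((x + 3) ∸_) (sym (leastCover-unique cover cover-value)) ⟩
    (x + 3) ∸ m           ≡⟨ sym (+-identityʳ _) ⟩
    (x + 3) ∸ m + 0 ∎
    where
    open ≡-Reasoning
    cover-value : IsLeastCover (x + 3) m″
    cover-value = 1≤m″ , <⇒≤ m″<k , ≤-reflexive (sym Mm″≡x+3) ,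
                  λ 1≤j j<m″ → subst (M _ <_) Mm″≡x+3 (M-< 1≤j j<m″ (<⇒≤ m″<k))
    cover-next : IsLeastCover (x + 4) (suc m″)
    cover-next = s≤s z≤n , m″<k ,
      subst₂ _≤_ (sym (+-suc x 3)) refl (subst (_< M (suc m″)) Mm″≡x+3 (M-suc 1≤m″ m″<k)) ,
      λ 1≤j j<1+m″ → ≤-trans (s≤s (subst (M _ ≤_) Mm″≡x+3 (M-mono 1≤j (≤-pred j<1+m″) (<⇒≤ m″<k))))
                             (≤-reflexive (sym (+-suc x 3)))
  letter-step {x} {m} {m′} x+3<n cover@(1≤m , m≤k , x+3≤Mm , minimal) cover′ | true = begin
    (x + 4) ∸ m′          ≡⟨ cong ((x + 4) ∸_) (leastCover-unique cover′ cover-next) ⟩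
    (x + 4) ∸ m           ≡⟨ cong (_∸ m) (sym (+-assoc x 3 1)) ⟩
    (x + 3 + 1) ∸ m       ≡⟨ +-∸-comm 1 (≤-trans (m≤m+n m 2) (leastCover+2≤ (m≤n+m 3 x) cover)) ⟩
    (x + 3) ∸ m + 1 ∎
    where
    open ≡-Reasoning
    Mm≢x+3 : M m ≢ x + 3
    Mm≢x+3 Mm≡ with m <? k
    ... | yes m<k = letter⇒¬value {x} (subst T (sym eq) tt) 1≤m m<k Mm≡
    ... | no m≮k = <-irrefl (trans (sym Mm≡) (trans (cong M (≤-antisym m≤k (≮⇒≥ m≮k))) M-k)) x+3<n
    cover-next : IsLeastCover (x + 4) m
    cover-next = 1≤m , m≤k ,
      subst₂ _≤_ (sym (+-suc x 3)) refl (≤∧≢⇒< x+3≤Mm (Mm≢x+3 ∘ sym)) ,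
      λ 1≤j j<m → ≤-trans (minimal 1≤j j<m) (≤-trans (n≤1+n _) (≤-reflexive (sym (+-suc x 3))))

  private
    +-bound : ∀ {A B C X Y} → A + 2 ≤ B + C → B < X → C < 3 + Y → A < X + Y
    +-bound {A} {B} {C} {X} {Y} A+2≤ B<X C<3+Y = +-cancelʳ-≤ 3 (suc A) (X + Y) (begin
      suc A + 3        ≡⟨ solve 1 (λ a → (con 1 :+ a) :+ con 3 := (a :+ con 2) :+ con 2) refl A ⟩
      (A + 2) + 2      ≤⟨ +-monoˡ-≤ 2 A+2≤ ⟩
      (B + C) + 2      ≡⟨ solve 2 (λ b c → (b :+ c) :+ con 2 := (con 1 :+ b) :+ (con 1 :+ c)) refl B C ⟩
      suc B + suc C    ≤⟨ +-mono-≤ B<X C<3+Y ⟩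
      X + (3 + Y)      ≡⟨ solve 2 (λ x y → x :+ (con 3 :+ y) := (x :+ y) :+ con 3) refl X Y ⟩
      X + Y + 3 ∎)
      where
      open ≤-Reasoning
      open +-*-Solver

  -- If M (q + 1) were ≥ 3 + l, none of M (q + 1), …, M (k - 1) would be below 3 + l.
  M-below-prefix : ∀ {l q} → #values 3 l ≡ suc q → M (suc q) < 3 + l
  M-below-prefix {l} {q} eq =
    ≰⇒> λ 3+l≤ → <-irrefl refl (≤-trans (≤-reflexive (sym eq)) (at-most-q 3+l≤))
    where
    q≤K : q ≤ K
    q≤K = ≤-pred (≤-trans (≤-reflexive (sym eq)) (≤-trans (countRange≤length _ 1 K) (n≤1+n K)))
    at-most-q : 3 + l ≤ M (suc q) → #values 3 l ≤ q
    at-most-q 3+l≤ = begin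
      #values 3 l
        ≡⟨ cong (countRange (valueIn 3 l) 1) (sym (m+[n∸m]≡n q≤K)) ⟩
      countRange (valueIn 3 l) 1 (q + (K ∸ q))
        ≡⟨ countRange-++ (valueIn 3 l) 1 q (K ∸ q) ⟩
      countRange (valueIn 3 l) 1 q + countRange (valueIn 3 l) (1 + q) (K ∸ q)
        ≡⟨ cong (countRange (valueIn 3 l) 1 q +_) (countRange-none _ (1 + q) (K ∸ q) none) ⟩
      countRange (valueIn 3 l) 1 q + 0
        ≤⟨ ≤-trans (≤-reflexive (+-identityʳ _)) (countRange≤length _ 1 q) ⟩
      q ∎
      where
      open ≤-Reasoning
      none : ∀ m → InRange (1 + q) (K ∸ q) m → ¬ T (valueIn 3 l m)
      none m (1+q≤m , m<) t = <⇒≱ (proj₂ (valueIn⁻ 3 l m t))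
        (≤-trans 3+l≤ (M-mono (s≤s z≤n) 1+q≤m
                             (≤-trans (<⇒≤ m<) (≤-reflexive (cong suc (m+[n∸m]≡n q≤K))))))

  cover-shift : ∀ {c l m₀ t} → 3 ≤ c → IsLeastCover c m₀ → m₀ + t ≤ k →
    M (suc t) < 3 + l → M (m₀ + t) < c + l
  cover-shift {l = l} {suc zero} 3≤c _ _ M1+t< = <-≤-trans M1+t< (+-monoˡ-≤ l 3≤c)
  cover-shift {c} {l} {suc (suc m₁)} {t} 3≤c (_ , _ , _ , minimal) m₀+t≤k M1+t< =
    subst (λ x → M x < c + l) (+-suc (suc m₁) t)
      (+-bound (M-subadditive (s≤s z≤n) (s≤s z≤n) (subst (_≤ k) (sym (+-suc (suc m₁) t)) m₀+t≤k))
               (minimal (s≤s z≤n) ≤-refl) M1+t<)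

  -- The q = #values 3 l values M 1, …, M q lie below 3 + l, so the q values
  -- M m₀, …, M (m₀ + q - 1) lie in [c, c + l).
  #values-prefix≤ : ∀ {c l m₀} → 3 ≤ c → c + l ≤ n → IsLeastCover c m₀ → #values 3 l ≤ #values c l
  #values-prefix≤ {c} {l} {m₀} 3≤c c+l≤n cover@(1≤m₀ , m₀≤k , c≤Mm₀ , _) with #values 3 l in eq
  ... | zero = z≤n
  ... | suc q = countRange≥run (valueIn c l) 1 K m₀ (suc q) 1≤m₀
                  (subst (_≤ k) (sym (+-suc m₀ q)) (inside q ≤-refl))
                  (λ t t<1+q → let t≤q = ≤-pred t<1+q in
                     valueIn⁺ (≤-trans c≤Mm₀ (M-mono 1≤m₀ (m≤m+n m₀ t) (<⇒≤ (inside t t≤q))))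
                               (bound t≤q (<⇒≤ (inside t t≤q))))
    where
    1+q≤k : suc q ≤ k
    1+q≤k = ≤-trans (≤-reflexive (sym eq)) (≤-trans (countRange≤length _ 1 K) (n≤1+n K))
    bound : ∀ {t} → t ≤ q → m₀ + t ≤ k → M (m₀ + t) < c + l
    bound t≤q m₀+t≤k = cover-shift 3≤c cover m₀+t≤k
      (≤-<-trans (M-mono (s≤s z≤n) (s≤s t≤q) 1+q≤k) (M-below-prefix eq))
    inside : ∀ t → t ≤ q → m₀ + t < k
    m₀+t≤k : ∀ t → t ≤ q → m₀ + t ≤ k
    inside t t≤q = below-top (m₀+t≤k t t≤q) (<-≤-trans (bound t≤q (m₀+t≤k t t≤q)) c+l≤n)
    m₀+t≤k zero _ = subst (_≤ k) (sym (+-identityʳ m₀)) m₀≤k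
    m₀+t≤k (suc t) 1+t≤q = subst (_≤ k) (sym (+-suc m₀ t)) (inside t (<⇒≤ 1+t≤q))

  factor≤prefix : ∀ i l → i + l ≤ n ∸ 3 → countRange letter i l ≤ countRange letter 0 l
  factor≤prefix i l i+l≤ = +-cancelʳ-≤ (#values (i + 3) l) _ _ (begin
    countRange letter i l + #values (i + 3) l
      ≡⟨ cong (countRange letter i l +_) (sym (zeros≡#values i l)) ⟩
    countRange letter i l + countRange (not ∘ letter) i l
      ≡⟨ countRange+countRange-not letter i l ⟩
    l
      ≡⟨ sym (countRange+countRange-not letter 0 l) ⟩
    countRange letter 0 l + countRange (not ∘ letter) 0 l
      ≡⟨ cong (countRange letter 0 l +_) (zeros≡#values 0 l) ⟩
    countRange letter 0 l + #values 3 l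
      ≤⟨ +-monoʳ-≤ _ (#values-prefix≤ (m≤n+m 3 i) c+l≤n (proj₂ (leastCover c≤n))) ⟩
    countRange letter 0 l + #values (i + 3) l ∎)
    where
    open ≤-Reasoning
    c+l≤n : i + 3 + l ≤ n
    c+l≤n = begin
      i + 3 + l  ≡⟨ solve 2 (λ i l → (i :+ con 3) :+ l := (i :+ l) :+ con 3) refl i l ⟩
      i + l + 3  ≤⟨ m≤o∸n⇒m+n≤o (i + l) n≥3 i+l≤ ⟩
      n ∎
      where open +-*-Solver
    c≤n : i + 3 ≤ n
    c≤n = ≤-trans (m≤m+n (i + 3) l) c+l≤n

  word : List Bool
  word = segment letter 0 (n ∸ 3)

  word-prefixNormal : PrefixNormal word
  word-prefixNormal i l i+l≤∣word∣ = begin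
    ones (take l (drop i word))
      ≡⟨ cong (ones ∘ take l) (drop-segment letter 0 (n ∸ 3) i i≤) ⟩
    ones (take l (segment letter i (n ∸ 3 ∸ i)))
      ≡⟨ cong ones (take-segment letter i (n ∸ 3 ∸ i) l l≤) ⟩
    ones (segment letter i l)
      ≡⟨ ones-segment letter i l ⟩
    countRange letter i l
      ≤⟨ factor≤prefix i l i+l≤ ⟩
    countRange letter 0 l
      ≡⟨ sym (ones-segment letter 0 l) ⟩
    ones (segment letter 0 l)
      ≡⟨ cong ones (sym (take-segment letter 0 (n ∸ 3) l (≤-trans (m≤n+m l i) i+l≤))) ⟩
    ones (take l word) ∎
    where
    open ≤-Reasoning
    i+l≤ : i + l ≤ n ∸ 3
    i+l≤ = subst (i + l ≤_) (length-segment letter 0 (n ∸ 3)) i+l≤∣word∣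
    i≤ : i ≤ n ∸ 3
    i≤ = ≤-trans (m≤m+n i l) i+l≤
    l≤ : l ≤ n ∸ 3 ∸ i
    l≤ = m+n≤o⇒m≤o∸n l (subst (_≤ n ∸ 3) (+-comm i l) i+l≤)

-- Caterpillars

module Caterpillar {n : ℕ} (G : Graph n) (tree : IsTree G) (n≥3 : 3 ≤ n)
                   (spine : InducesPath G (nonLeaves G)) where

  spineList : List (Fin n)
  spineList = proj₁ spine

  k : ℕ
  k = length spineList

  private
    origin : Fin n
    origin = fromℕ< (≤-trans (s≤s z≤n) n≥3)

    spine-unique : Unique spineList
    spine-unique = proj₁ (proj₂ spine)

    spine-members : ∀ v → (v ∈ nonLeaves G) ⇔ (v ∈ₗ spineList)
    spine-members = proj₁ (proj₂ (proj₂ spine))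

    spine-linked : Linked (Adj G) spineList
    spine-linked = proj₁ (proj₂ (proj₂ (proj₂ spine)))

    spine-chordless : ∀ (i j : Fin k) → suc (toℕ i) < toℕ j →
      ¬ Adj G (List.lookup spineList i) (List.lookup spineList j)
    spine-chordless = proj₂ (proj₂ (proj₂ (proj₂ spine)))

  spineAt : ℕ → Fin n
  spineAt = lookupOr origin spineList

  connected : ConnectedIn G (allVertices G)
  connected = proj₁ tree

  opaque
    degree : Fin n → ℕ
    degree v = degIn G (allVertices G) v

    onSpine : Fin n → Bool
    onSpine v = not (degree v ≡ᵇ 1)

    degree≡degIn : ∀ v → degree v ≡ degIn G (allVertices G) v
    degree≡degIn v = refl

    degree≥1 : ∀ v → 1 ≤ degree v
    degree≥1 v with ∣S∣≥2⇒other G (subst (2 ≤_) (sym (∣allVertices∣≡n G)) (≤-trans (n≤1+n 2) n≥3))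
                                  (∈-allVertices G v)
    ... | u , u∈ , u≢v = connected⇒degIn≥1 G connected (∈-allVertices G v) u∈ (u≢v ∘ sym)

    spine⇒∈ : ∀ {v} → T (onSpine v) → v ∈ₗ spineList
    spine⇒∈ {v} t = Equivalence.to (spine-members v) (∈-tabulate⁺ G t)

    ∈⇒spine : ∀ {v} → v ∈ₗ spineList → T (onSpine v)
    ∈⇒spine {v} v∈ = ∈-tabulate⁻ G (Equivalence.from (spine-members v) v∈)

    spine? : ∀ v → T (onSpine v) ⊎ ¬ T (onSpine v)
    spine? v with onSpine v
    ... | true = inj₁ tt
    ... | false = inj₂ λ ()

    leaf⇒degree≡1 : ∀ {v} → ¬ T (onSpine v) → degree v ≡ 1
    leaf⇒degree≡1 {v} leaf with degree v ≡ᵇ 1 in eq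
    ... | true = ≡ᵇ⇒≡ _ _ (subst T (sym eq) tt)
    ... | false = ⊥-elim (leaf tt)

    spine⇒degree≥2 : ∀ {v} → T (onSpine v) → 2 ≤ degree v
    spine⇒degree≥2 {v} t with degree v | degree≥1 v | not-elim t ∘ ≡⇒≡ᵇ (degree v) 1
    ... | suc zero | _ | ≢1 = ⊥-elim (≢1 refl)
    ... | suc (suc _) | _ | _ = s≤s (s≤s z≤n)

    stem : Fin n → Fin n
    stem v = proj₁ (neighbour G {allVertices G} (degree≥1 v))

    stem-adjacent : ∀ v → Adj G v (stem v)
    stem-adjacent v = proj₂ (proj₂ (neighbour G {allVertices G} (degree≥1 v)))

    leaf-neighbour : ∀ {v w} → ¬ T (onSpine v) → Adj G v w → w ≡ stem v
    leaf-neighbour {v} {w} leaf v~w =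
      degIn≤1⇒unique G (≤-reflexive (leaf⇒degree≡1 leaf)) (∈-allVertices G w) v~w
                       (∈-allVertices G (stem v)) (stem-adjacent v)

    stem-spine : ∀ {v} → ¬ T (onSpine v) → T (onSpine (stem v))
    stem-spine {v} leaf with spine? (stem v)
    ... | inj₁ t = t
    ... | inj₂ leaf′ = ⊥-elim (<⇒≱ (subst (2 <_) (sym (∣allVertices∣≡n G)) n≥3)
             (adjacent-leaves⇒∣S∣≤2 G connected (∈-allVertices G v) (∈-allVertices G (stem v))
                                    (leaf⇒degree≡1 leaf) (leaf⇒degree≡1 leaf′) (stem-adjacent v)))

    -- position v is the index on the spine of v itself if v is a spine vertex and of its
    -- unique neighbour if v is a leaf
    anchor : Fin n → Fin n
    anchor v = if onSpine v then v else stem v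

    anchor-spine≡ : ∀ {v} → T (onSpine v) → anchor v ≡ v
    anchor-spine≡ {v} t with onSpine v
    ... | true = refl

    anchor-leaf≡ : ∀ {v} → ¬ T (onSpine v) → anchor v ≡ stem v
    anchor-leaf≡ {v} leaf with onSpine v
    ... | true = ⊥-elim (leaf tt)
    ... | false = refl

  anchor-spine : ∀ v → T (onSpine (anchor v))
  anchor-spine v with spine? v
  ... | inj₁ t = subst (T ∘ onSpine) (sym (anchor-spine≡ t)) t
  ... | inj₂ leaf = subst (T ∘ onSpine) (sym (anchor-leaf≡ leaf)) (stem-spine leaf)

  position : Fin n → ℕ
  position v = indexOf origin (anchor v) spineList

  position<k : ∀ v → position v < k
  position<k v = proj₁ (indexOf-∈ origin spineList (spine⇒∈ (anchor-spine v)))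

  spineAt-position : ∀ {v} → T (onSpine v) → spineAt (position v) ≡ v
  spineAt-position {v} t =
    trans (proj₂ (indexOf-∈ origin spineList (spine⇒∈ (anchor-spine v)))) (anchor-spine≡ t)

  spineAt-spine : ∀ {j} → j < k → T (onSpine (spineAt j))
  spineAt-spine {j} j<k = ∈⇒spine (lookupOr-∈ origin spineList j j<k)

  position-spineAt : ∀ {j} → j < k → position (spineAt j) ≡ j
  position-spineAt {j} j<k =
    trans (cong (λ v → indexOf origin v spineList) (anchor-spine≡ (spineAt-spine j<k)))
          (indexOf-lookupOr origin spineList j spine-unique j<k)

  position-injective : ∀ {u w} → T (onSpine u) → T (onSpine w) → position u ≡ position w → u ≡ w
  position-injective tu tw eq =
    trans (sym (spineAt-position tu)) (trans (cong spineAt eq) (spineAt-position tw))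

  position-leaf : ∀ {v} → ¬ T (onSpine v) → position v ≡ position (stem v)
  position-leaf {v} leaf = cong (λ u → indexOf origin u spineList)
                                (trans (anchor-leaf≡ leaf) (sym (anchor-spine≡ (stem-spine leaf))))

  k≥1 : 1 ≤ k
  k≥1 = ≤-trans (s≤s z≤n) (position<k origin)

  spineAt-adjacent : ∀ {j} → suc j < k → Adj G (spineAt j) (spineAt (suc j))
  spineAt-adjacent {j} = Linked-lookupOr origin spineList spine-linked j

  spineAt-nonadjacent : ∀ {i j} → suc i < j → j < k → ¬ Adj G (spineAt i) (spineAt j)
  spineAt-nonadjacent {i} {j} 1+i<j j<k =
    spine-chordless (fromℕ< i<k) (fromℕ< j<k)
      (subst₂ (λ x y → suc x < y) (sym (Fin.toℕ-fromℕ< i<k)) (sym (Fin.toℕ-fromℕ< j<k)) 1+i<j)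
    ∘ subst₂ (Adj G) (at i<k) (at j<k)
    where
    i<k = <-trans (<-trans (n<1+n i) 1+i<j) j<k
    at : ∀ {x} (x<k : x < k) → spineAt x ≡ List.lookup spineList (fromℕ< x<k)
    at x<k = trans (cong spineAt (sym (Fin.toℕ-fromℕ< x<k))) (lookupOr-toℕ origin spineList (fromℕ< x<k))

  leaf-adjacent : ∀ {u w} → Adj G u w → ¬ T (onSpine u) → T (onSpine w) × position w ≡ position u
  leaf-adjacent {u} a leaf = subst (T ∘ onSpine) (sym w≡stem) (stem-spine leaf) ,
                             trans (cong position w≡stem) (sym (position-leaf leaf))
    where w≡stem = leaf-neighbour leaf a

  spine-adjacent≤ : ∀ {u w} → Adj G u w → T (onSpine u) → T (onSpine w) → position w ≤ suc (position u)
  spine-adjacent≤ {u} {w} a tu tw with suc (position u) <? position w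
  ... | no ≮ = ≮⇒≥ ≮
  ... | yes 1+pu<pw = ⊥-elim (spineAt-nonadjacent 1+pu<pw (position<k w)
                               (subst₂ (Adj G) (sym (spineAt-position tu)) (sym (spineAt-position tw)) a))

  spine-adjacent≢ : ∀ {u w} → Adj G u w → T (onSpine u) → T (onSpine w) → position u ≢ position w
  spine-adjacent≢ {u} a tu tw eq = Adj-irrefl G (subst (Adj G u) (sym (position-injective tu tw eq)) a)

  spine-adjacent : ∀ {u w} → Adj G u w → T (onSpine u) → T (onSpine w) →
    position w ≡ suc (position u) ⊎ position u ≡ suc (position w)
  spine-adjacent {u} {w} a tu tw with <-cmp (position u) (position w)
  ... | tri< pu<pw _ _ = inj₁ (≤-antisym (spine-adjacent≤ a tu tw) pu<pw)
  ... | tri≈ _ pu≡pw _ = ⊥-elim (spine-adjacent≢ a tu tw pu≡pw)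
  ... | tri> _ _ pw<pu = inj₂ (≤-antisym (spine-adjacent≤ (Adj-sym G a) tw tu) pw<pu)

  -- Windows

  inWindow : ℕ → ℕ → Fin n → Bool
  inWindow a m v = if onSpine v then (a ≤ᵇ suc (position v)) ∧ (position v ≤ᵇ a + m)
                                else (a ≤ᵇ position v) ∧ (position v <ᵇ a + m)

  window : ℕ → ℕ → Subset n
  window a m = tabulate (inWindow a m)

  private
    inWindow-spine : ∀ {a m v} → T (onSpine v) →
      inWindow a m v ≡ ((a ≤ᵇ suc (position v)) ∧ (position v ≤ᵇ a + m))
    inWindow-spine {v = v} t with onSpine v
    ... | true = refl

    inWindow-leaf : ∀ {a m v} → ¬ T (onSpine v) →
      inWindow a m v ≡ ((a ≤ᵇ position v) ∧ (position v <ᵇ a + m))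
    inWindow-leaf {v = v} leaf with onSpine v
    ... | true = ⊥-elim (leaf tt)
    ... | false = refl

  window-spine⁺ : ∀ {a m v} → T (onSpine v) → a ≤ suc (position v) → position v ≤ a + m → T (inWindow a m v)
  window-spine⁺ {a} {m} t a≤ ≤a+m =
    subst T (sym (inWindow-spine {a} {m} t)) (∧-intro (≤⇒≤ᵇ a≤) (≤⇒≤ᵇ ≤a+m))

  window-spine⁻ : ∀ {a m v} → T (onSpine v) → T (inWindow a m v) → a ≤ suc (position v) × position v ≤ a + m
  window-spine⁻ {a} {m} {v} t w = let w′ = subst T (inWindow-spine {a} {m} t) w in
    ≤ᵇ⇒≤ _ _ (∧-elimˡ {a ≤ᵇ suc (position v)} w′) ,
    ≤ᵇ⇒≤ _ _ (∧-elimʳ {a ≤ᵇ suc (position v)} w′)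

  window-leaf⁺ : ∀ {a m v} → ¬ T (onSpine v) → a ≤ position v → position v < a + m → T (inWindow a m v)
  window-leaf⁺ {a} {m} leaf a≤ <a+m =
    subst T (sym (inWindow-leaf {a} {m} leaf)) (∧-intro (≤⇒≤ᵇ a≤) (<⇒<ᵇ <a+m))

  window-leaf⁻ : ∀ {a m v} → ¬ T (onSpine v) → T (inWindow a m v) → a ≤ position v × position v < a + m
  window-leaf⁻ {a} {m} {v} leaf w = let w′ = subst T (inWindow-leaf {a} {m} leaf) w in
    ≤ᵇ⇒≤ _ _ (∧-elimˡ {a ≤ᵇ position v} w′) , <ᵇ⇒< _ _ (∧-elimʳ {a ≤ᵇ position v} w′)

  window-⊆ : ∀ {a m a′ m′} → a′ ≤ a → a + m ≤ a′ + m′ →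
    ∀ v → T (inWindow a m v) → T (inWindow a′ m′ v)
  window-⊆ {a} {m} {a′} {m′} a′≤a a+m≤ v w with spine? v
  ... | inj₁ t = let a≤ , ≤a+m = window-spine⁻ {a} {m} t w in
                 window-spine⁺ {a′} {m′} t (≤-trans a′≤a a≤) (≤-trans ≤a+m a+m≤)
  ... | inj₂ leaf = let a≤ , <a+m = window-leaf⁻ {a} {m} leaf w in
                    window-leaf⁺ {a′} {m′} leaf (≤-trans a′≤a a≤) (<-≤-trans <a+m a+m≤)

  window-+ : ∀ {a m₁ m₂} v → T (inWindow a (m₁ + m₂) v) → T (inWindow a m₁ v ∨ inWindow (a + m₁) m₂ v)
  window-+ {a} {m₁} {m₂} v w with spine? v
  ... | inj₁ t with window-spine⁻ {a} {m₁ + m₂} t w | position v ≤? a + m₁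
  ...   | a≤ , _ | yes pv≤ = ∨-introˡ (window-spine⁺ {a} {m₁} t a≤ pv≤)
  ...   | _ , ≤a+m | no pv≰ = ∨-introʳ {inWindow a m₁ v}
          (window-spine⁺ {a + m₁} {m₂} t (≤-trans (<⇒≤ (≰⇒> pv≰)) (n≤1+n _))
                                         (≤-trans ≤a+m (≤-reflexive (sym (+-assoc a m₁ m₂)))))
  window-+ {a} {m₁} {m₂} v w | inj₂ leaf with window-leaf⁻ {a} {m₁ + m₂} leaf w | position v <? a + m₁
  ...   | a≤ , _ | yes pv< = ∨-introˡ (window-leaf⁺ {a} {m₁} leaf a≤ pv<)
  ...   | _ , <a+m | no pv≮ = ∨-introʳ {inWindow a m₁ v}
          (window-leaf⁺ {a + m₁} {m₂} leaf (≮⇒≥ pv≮)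
                        (<-≤-trans <a+m (≤-reflexive (sym (+-assoc a m₁ m₂)))))

  spineAt-window : ∀ {a m j} → j < k → a ≤ suc j → j ≤ a + m → T (inWindow a m (spineAt j))
  spineAt-window {a} {m} j<k a≤ ≤a+m = window-spine⁺ {a} {m} (spineAt-spine j<k)
    (subst (λ p → a ≤ suc p) (sym (position-spineAt j<k)) a≤) (subst (_≤ a + m) (sym (position-spineAt j<k)) ≤a+m)

  neighbour-window : ∀ {a m x w} → T (onSpine x) → a ≤ position x → position x < a + m → Adj G x w →
    T (inWindow a m w)
  neighbour-window {a} {m} {x} {w} tx a≤ <a+m x~w with spine? w
  ... | inj₁ tw = window-spine⁺ {a} {m} tw (≤-trans a≤ (spine-adjacent≤ (Adj-sym G x~w) tw tx))
                                            (≤-trans (spine-adjacent≤ x~w tx tw) <a+m)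
  ... | inj₂ leaf = let px≡pw = proj₂ (leaf-adjacent (Adj-sym G x~w) leaf) in
                    window-leaf⁺ {a} {m} leaf (subst (a ≤_) px≡pw a≤) (subst (_< a + m) px≡pw <a+m)

  inSegment : ℕ → ℕ → Fin n → Bool
  inSegment a m v = onSpine v ∧ ((a ≤ᵇ position v) ∧ (position v <ᵇ a + m))

  inSegment⁺ : ∀ {a m v} → T (onSpine v) → a ≤ position v → position v < a + m → T (inSegment a m v)
  inSegment⁺ t a≤ <a+m = ∧-intro t (∧-intro (≤⇒≤ᵇ a≤) (<⇒<ᵇ <a+m))

  inSegment⁻ : ∀ {a m v} → T (inSegment a m v) → T (onSpine v) × a ≤ position v × position v < a + m
  inSegment⁻ {a} {m} {v} s = let t , s′ = ∧-elimˡ {onSpine v} s , ∧-elimʳ {onSpine v} s in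
    t , ≤ᵇ⇒≤ _ _ (∧-elimˡ {a ≤ᵇ position v} s′) , <ᵇ⇒< _ _ (∧-elimʳ {a ≤ᵇ position v} s′)

  module WindowTree (a m : ℕ) (1≤m : 1 ≤ m) (a+m≤k : a + m ≤ k) where

    private
      S : Subset n
      S = window a m

      a<k : a < k
      a<k = <-≤-trans (m<m+n a 1≤m) a+m≤k

      spineAt∈S : ∀ {j} → j < k → a ≤ suc j → j ≤ a + m → spineAt j ∈ S
      spineAt∈S j<k a≤ ≤a+m = ∈-tabulate⁺ G (spineAt-window {a} {m} j<k a≤ ≤a+m)

      start∈S : spineAt a ∈ S
      start∈S = spineAt∈S a<k (n≤1+n a) (m≤m+n a m)

      along : ∀ t → a + t ≤ a + m → a + t < k → WalkIn G S (spineAt a) (spineAt (a + t))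
      along zero _ _ = subst (λ j → WalkIn G S (spineAt a) (spineAt j)) (sym (+-identityʳ a)) (here start∈S)
      along (suc t) a+1+t≤ a+1+t<k = WalkIn-++ G (along t a+t≤ (<-trans a+t< a+1+t<k))
        (step (spineAt∈S (<-trans a+t< a+1+t<k) (≤-trans (m≤m+n a t) (n≤1+n _)) a+t≤)
              (subst (λ j → Adj G (spineAt (a + t)) (spineAt j)) (sym (+-suc a t))
                     (spineAt-adjacent (subst (_< k) (+-suc a t) a+1+t<k)))
              (here (spineAt∈S a+1+t<k (≤-trans (m≤m+n a (suc t)) (n≤1+n _)) a+1+t≤)))
        where
        a+t< : a + t < a + suc t
        a+t< = +-monoʳ-< a (n<1+n t)
        a+t≤ : a + t ≤ a + m
        a+t≤ = <⇒≤ (<-≤-trans a+t< a+1+t≤)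

      spine-to-start : ∀ {j} → j < k → a ≤ suc j → j ≤ a + m → WalkIn G S (spineAt j) (spineAt a)
      spine-to-start {j} j<k a≤1+j j≤a+m with a ≤? j
      ... | yes a≤j = subst (λ i → WalkIn G S (spineAt i) (spineAt a)) (m+[n∸m]≡n a≤j)
          (WalkIn-reverse G (along (j ∸ a) (subst (_≤ a + m) (sym (m+[n∸m]≡n a≤j)) j≤a+m)
                                           (subst (_< k) (sym (m+[n∸m]≡n a≤j)) j<k)))
      ... | no a≰j = step (spineAt∈S j<k a≤1+j j≤a+m)
          (subst (λ i → Adj G (spineAt j) (spineAt i)) 1+j≡a (spineAt-adjacent (subst (_< k) (sym 1+j≡a) a<k)))
          (here start∈S)
        where 1+j≡a = ≤-antisym (≰⇒> a≰j) a≤1+j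

      to-start : ∀ {x} → x ∈ S → WalkIn G S x (spineAt a)
      to-start {x} x∈S with spine? x
      ... | inj₁ t = let a≤ , ≤a+m = window-spine⁻ {a} {m} t (∈-tabulate⁻ G x∈S) in
          subst (λ y → WalkIn G S y (spineAt a)) (spineAt-position t) (spine-to-start (position<k x) a≤ ≤a+m)
      ... | inj₂ leaf = let a≤ , <a+m = window-leaf⁻ {a} {m} leaf (∈-tabulate⁻ G x∈S)
                            px≡ = position-leaf leaf in
          step x∈S (stem-adjacent x)
            (subst (λ y → WalkIn G S y (spineAt a)) (spineAt-position (stem-spine leaf))
              (spine-to-start (position<k _) (≤-trans (subst (a ≤_) px≡ a≤) (n≤1+n _))
                                             (<⇒≤ (subst (_< a + m) px≡ <a+m))))

    subtree : InducesTree G S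
    subtree = (λ x y x∈S y∈S → WalkIn-++ G (to-start x∈S) (WalkIn-reverse G (to-start y∈S))) ,
              subtree-acyclic G tree S

    private
      only-neighbour⇒degIn≡1 : ∀ {x y} → y ∈ S → Adj G x y → (∀ {w} → w ∈ S → Adj G x w → w ≡ y) →
        degIn G S x ≡ 1
      only-neighbour⇒degIn≡1 {x} {y} y∈S x~y only = ≤-antisym
        (subst (_≤ 1) (sym (degIn≡count G S x))
               (count≤1 _ y λ w t → only (T⇒∈ G (∧-elimˡ {lookup S w} t)) (∧-elimʳ {lookup S w} t)))
        (degIn≥1 G y∈S x~y)

      off-segment : ∀ {x} → T (onSpine x) → a ≤ suc (position x) → position x ≤ a + m →
        ¬ T (inSegment a m x) → suc (position x) ≡ a ⊎ position x ≡ a + m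
      off-segment {x} t a≤ ≤a+m off with a ≤? position x | position x <? a + m
      ... | no a≰ | _ = inj₁ (≤-antisym (≰⇒> a≰) a≤)
      ... | yes _ | no ≮ = inj₂ (≤-antisym ≤a+m (≮⇒≥ ≮))
      ... | yes a≤′ | yes < = ⊥-elim (off (inSegment⁺ t a≤′ <))

      hanging-leaf : ∀ {x} → ¬ T (onSpine x) → T (inWindow a m x) → degIn G S x ≡ 1
      hanging-leaf {x} leaf x∈W = let a≤ , <a+m = window-leaf⁻ {a} {m} leaf x∈W
                                      px≡ = position-leaf leaf in
        only-neighbour⇒degIn≡1
          (∈-tabulate⁺ G (window-spine⁺ {a} {m} (stem-spine leaf) (≤-trans (subst (a ≤_) px≡ a≤) (n≤1+n _))
                                                                (<⇒≤ (subst (_< a + m) px≡ <a+m))))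
          (stem-adjacent x) (λ _ → leaf-neighbour leaf)

      left-end : ∀ {x} → T (onSpine x) → suc (position x) ≡ a → degIn G S x ≡ 1
      left-end {x} t 1+px≡a = only-neighbour⇒degIn≡1 start∈S
        (subst₂ (Adj G) (spineAt-position t) (cong spineAt 1+px≡a) (spineAt-adjacent (subst (_< k) (sym 1+px≡a) a<k)))
        only
        where
        only : ∀ {w} → w ∈ S → Adj G x w → w ≡ spineAt a
        only {w} w∈S x~w with spine? w
        ... | inj₂ leaf = let a≤pw , _ = window-leaf⁻ {a} {m} leaf (∈-tabulate⁻ G w∈S) in
          ⊥-elim (<-irrefl refl (≤-trans (≤-reflexive 1+px≡a)
                                  (≤-trans a≤pw (≤-reflexive (sym (proj₂ (leaf-adjacent (Adj-sym G x~w) leaf)))))))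
        ... | inj₁ tw with spine-adjacent x~w t tw
        ...   | inj₁ pw≡1+px =
          position-injective tw (spineAt-spine a<k) (trans (trans pw≡1+px 1+px≡a) (sym (position-spineAt a<k)))
        ...   | inj₂ px≡1+pw = ⊥-elim (<-irrefl refl (≤-trans (≤-reflexive (cong suc (sym px≡1+pw)))
          (≤-trans (≤-reflexive 1+px≡a) (proj₁ (window-spine⁻ {a} {m} tw (∈-tabulate⁻ G w∈S))))))

      right-end : ∀ {x} → T (onSpine x) → position x ≡ a + m → degIn G S x ≡ 1
      right-end {x} t px≡a+m = only-neighbour⇒degIn≡1
        (spineAt∈S e<k (≤-trans a≤e (n≤1+n e)) (≤-trans (n≤1+n e) (≤-reflexive 1+e≡a+m)))
        (Adj-sym G (subst (Adj G (spineAt e)) (trans (cong spineAt 1+e≡px) (spineAt-position t))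
                          (spineAt-adjacent (subst (_< k) (sym 1+e≡px) (position<k x)))))
        only
        where
        e = pred (a + m)
        1+e≡a+m : suc e ≡ a + m
        1+e≡a+m = suc-pred (a + m) {{>-nonZero (≤-trans 1≤m (m≤n+m m a))}}
        1+e≡px : suc e ≡ position x
        1+e≡px = trans 1+e≡a+m (sym px≡a+m)
        e<k : e < k
        e<k = ≤-trans (≤-reflexive 1+e≡a+m) a+m≤k
        a≤e : a ≤ e
        a≤e = ≤-pred (≤-trans (m<m+n a 1≤m) (≤-reflexive (sym 1+e≡a+m)))
        only : ∀ {w} → w ∈ S → Adj G x w → w ≡ spineAt e
        only {w} w∈S x~w with spine? w
        ... | inj₂ leaf = let _ , pw<a+m = window-leaf⁻ {a} {m} leaf (∈-tabulate⁻ G w∈S) in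
          ⊥-elim (<-irrefl (trans (sym (proj₂ (leaf-adjacent (Adj-sym G x~w) leaf))) px≡a+m) pw<a+m)
        ... | inj₁ tw with spine-adjacent x~w t tw
        ...   | inj₁ pw≡1+px = ⊥-elim (<-irrefl refl (≤-trans (≤-reflexive (cong suc (sym px≡a+m)))
          (≤-trans (≤-reflexive (sym pw≡1+px)) (proj₂ (window-spine⁻ {a} {m} tw (∈-tabulate⁻ G w∈S))))))
        ...   | inj₂ px≡1+pw = position-injective tw (spineAt-spine e<k)
                                 (trans (suc-injective (trans (sym px≡1+pw) (sym 1+e≡px))) (sym (position-spineAt e<k)))

    off-segment⇒leaf : ∀ {x} → T (inWindow a m x) → ¬ T (inSegment a m x) → degIn G S x ≡ 1
    off-segment⇒leaf {x} x∈W off with spine? x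
    ... | inj₂ leaf = hanging-leaf leaf x∈W
    ... | inj₁ t with window-spine⁻ {a} {m} t x∈W
    ...   | a≤ , ≤a+m with off-segment t a≤ ≤a+m off
    ...     | inj₁ 1+px≡a = left-end t 1+px≡a
    ...     | inj₂ px≡a+m = right-end t px≡a+m

    ∣window∣≤leaves+m : ∣ S ∣ ≤ leavesIn G S + m
    ∣window∣≤leaves+m = begin
      ∣ S ∣
        ≡⟨ ∣tabulate∣≡count (inWindow a m) ⟩
      count (inWindow a m)
        ≡⟨ count-split (inWindow a m) (inSegment a m) ⟩
      count (λ v → inWindow a m v ∧ inSegment a m v) + count (λ v → inWindow a m v ∧ not (inSegment a m v))
        ≤⟨ +-mono-≤ on-segment off-segment-leaves ⟩
      m + leavesIn G S
        ≡⟨ +-comm m _ ⟩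
      leavesIn G S + m ∎
      where
      open ≤-Reasoning
      on-segment : count (λ v → inWindow a m v ∧ inSegment a m v) ≤ m
      on-segment = count≤-injective _ (λ v → position v ∸ a) m
        (λ v t → let _ , a≤ , <a+m = inSegment⁻ {a} {m} (∧-elimʳ {inWindow a m v} t) in
                 subst (position v ∸ a <_) (m+n∸m≡n a m) (∸-monoˡ-< <a+m a≤))
        (λ {u} {v} tu tv eq → let su , a≤u , _ = inSegment⁻ {a} {m} (∧-elimʳ {inWindow a m u} tu)
                                  sv , a≤v , _ = inSegment⁻ {a} {m} (∧-elimʳ {inWindow a m v} tv) in
                              position-injective su sv (∸-cancelʳ-≡ a≤u a≤v eq))
      off-segment-leaves : count (λ v → inWindow a m v ∧ not (inSegment a m v)) ≤ leavesIn G S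
      off-segment-leaves =
        subst (count (λ v → inWindow a m v ∧ not (inSegment a m v)) ≤_) (sym (leavesIn≡count G S))
          (count-mono _ _ λ v t → let v∈W = ∧-elimˡ {inWindow a m v} t in
            ∧-intro (∈⇒T G (∈-tabulate⁺ G v∈W))
                    (≡⇒≡ᵇ _ _ (off-segment⇒leaf v∈W (not-elim (∧-elimʳ {inWindow a m v} t)))))

  M : ℕ → ℕ
  M m = maxUpTo (λ a → count (inWindow a m)) (k ∸ m)

  M-upper : ∀ {a m} → a + m ≤ k → count (inWindow a m) ≤ M m
  M-upper {a} {m} a+m≤k =
    maxUpTo-upper (λ a → count (inWindow a m)) (subst (_≤ k ∸ m) (m+n∸n≡m a m) (∸-monoˡ-≤ m a+m≤k))

  M-attained : ∀ {m} → m ≤ k → ∃ λ a → a + m ≤ k × count (inWindow a m) ≡ M m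
  M-attained {m} m≤k with maxUpTo-attained (λ a → count (inWindow a m)) (k ∸ m)
  ... | a , a≤ , eq = a , ≤-trans (+-monoˡ-≤ m a≤) (≤-reflexive (m∸n+n≡m m≤k)) , sym eq

  M-realised : ∀ {m} → 1 ≤ m → m ≤ k →
    Σ (Subset n) λ S → InducesTree G S × ∣ S ∣ ≡ M m × M m ≤ leavesIn G S + m
  M-realised {m} 1≤m m≤k with M-attained m≤k
  ... | a , a+m≤k , eq =
    window a m , W.subtree , ∣W∣≡M , subst (_≤ leavesIn G (window a m) + m) ∣W∣≡M W.∣window∣≤leaves+m
    where
    module W = WindowTree a m 1≤m a+m≤k
    ∣W∣≡M : ∣ window a m ∣ ≡ M m
    ∣W∣≡M = trans (∣tabulate∣≡count (inWindow a m)) eq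

  spine⇒neighbour≢ : ∀ {x} → T (onSpine x) → ∀ y → ∃ λ w → Adj G x w × w ≢ y
  spine⇒neighbour≢ {x} t y
    with degIn≥2⇒neighbour≢ G {allVertices G} (subst (2 ≤_) (degree≡degIn x) (spine⇒degree≥2 t)) y
  ... | w , _ , x~w , w≢y = w , x~w , w≢y

  M-1 : 3 ≤ M 1
  M-1 = ≤-trans three (M-upper {0} {1} k≥1)
    where
    x = spineAt 0
    tx = spineAt-spine k≥1
    px≡0 = position-spineAt k≥1
    x∈W : T (inWindow 0 1 x)
    x∈W = window-spine⁺ {0} {1} tx z≤n (≤-trans (≤-reflexive px≡0) z≤n)
    three : 3 ≤ count (inWindow 0 1)
    three = subst (3 ≤_) (sym (count-remove (inWindow 0 1) x∈W))
      (s≤s (≤-trans (subst (2 ≤_) (trans (degree≡degIn x) (degIn≡count G (allVertices G) x))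
                           (spine⇒degree≥2 tx))
        (count-mono _ _ λ w t → let x~w = ∧-elimʳ {lookup (allVertices G) w} t in
          ∧-intro (neighbour-window {0} {1} tx z≤n (s≤s (≤-reflexive px≡0)) x~w)
                  (≢⇒not-≟ᵇ λ { refl → Adj-irrefl G x~w }))))

  M-k : M k ≡ n
  M-k = trans (cong (maxUpTo (λ a → count (inWindow a k))) (n∸n≡0 k))
              (count-all (inWindow 0 k) everything)
    where
    everything : ∀ v → T (inWindow 0 k v)
    everything v with spine? v
    ... | inj₁ t = window-spine⁺ {0} {k} t z≤n (<⇒≤ (position<k v))
    ... | inj₂ leaf = window-leaf⁺ {0} {k} leaf z≤n (position<k v)

  fresh-right : ∀ {a m w} → 1 ≤ m → a + m < k → Adj G (spineAt (a + m)) w → w ≢ spineAt (pred (a + m)) →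
    ¬ T (inWindow a m w)
  fresh-right {a} {m} {w} 1≤m a+m<k x~w w≢ w∈W with spine? w
  ... | inj₂ leaf = <-irrefl (trans (sym (proj₂ (leaf-adjacent (Adj-sym G x~w) leaf))) (position-spineAt a+m<k))
                             (proj₂ (window-leaf⁻ {a} {m} leaf w∈W))
  ... | inj₁ tw with spine-adjacent x~w (spineAt-spine a+m<k) tw
  ...   | inj₁ pw≡ = <-irrefl refl (≤-trans (≤-reflexive (cong suc (sym (position-spineAt a+m<k))))
                                   (≤-trans (≤-reflexive (sym pw≡)) (proj₂ (window-spine⁻ {a} {m} tw w∈W))))
  ...   | inj₂ px≡ = w≢ (position-injective tw (spineAt-spine e<k)
    (trans (suc-injective (trans (sym px≡) (trans (position-spineAt a+m<k) (sym 1+e≡))))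
           (sym (position-spineAt e<k))))
    where
    1+e≡ : suc (pred (a + m)) ≡ a + m
    1+e≡ = suc-pred (a + m) {{>-nonZero (≤-trans 1≤m (m≤n+m m a))}}
    e<k : pred (a + m) < k
    e<k = <-trans (≤-reflexive 1+e≡) a+m<k

  fresh-left : ∀ {a m j w} → suc j ≡ a → a < k → Adj G (spineAt j) w → w ≢ spineAt a → ¬ T (inWindow a m w)
  fresh-left {m = m} {j} {w} refl 1+j<k x~w w≢ w∈W with spine? w
  ... | inj₂ leaf = <-irrefl refl (≤-trans (proj₁ (window-leaf⁻ {suc j} {m} leaf w∈W))
                       (≤-reflexive (trans (sym (proj₂ (leaf-adjacent (Adj-sym G x~w) leaf))) (position-spineAt j<k))))
    where j<k = <-trans (n<1+n j) 1+j<k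
  ... | inj₁ tw with spine-adjacent x~w (spineAt-spine (<-trans (n<1+n j) 1+j<k)) tw
  ...   | inj₁ pw≡ = w≢ (position-injective tw (spineAt-spine 1+j<k)
                          (trans pw≡ (trans (cong suc (position-spineAt (<-trans (n<1+n j) 1+j<k)))
                                            (sym (position-spineAt 1+j<k)))))
  ...   | inj₂ px≡ = <-irrefl refl (≤-trans (proj₁ (window-spine⁻ {suc j} {m} tw w∈W))
                                            (≤-reflexive (trans (sym px≡) (position-spineAt (<-trans (n<1+n j) 1+j<k)))))

  private
    M-grow : ∀ {a m a′ m′} → a′ + m′ ≤ k → a′ ≤ a → a + m ≤ a′ + m′ →
      count (inWindow a m) ≡ M m → ∀ w → T (inWindow a′ m′ w) → ¬ T (inWindow a m w) → M m < M m′
    M-grow {a} {m} {a′} {m′} a′+m′≤k a′≤a ≤a′+m′ eq w w∈W′ w∉W =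
      subst (_< M m′) eq (<-≤-trans (count-<-mono _ _ (window-⊆ a′≤a ≤a′+m′) w w∈W′ w∉W)
                                    (M-upper {a′} {m′} a′+m′≤k))

  -- A largest window grows by a fresh neighbour of the next spine vertex, to the right if
  -- there is one and to the left otherwise.
  M-suc : ∀ {m} → 1 ≤ m → m < k → M m < M (suc m)
  M-suc {m} 1≤m m<k with M-attained (<⇒≤ m<k)
  ... | a , a+m≤k , eq with a + m <? k
  ...   | yes a+m<k with spine⇒neighbour≢ (spineAt-spine a+m<k) (spineAt (pred (a + m)))
  ...     | w , x~w , w≢ =
    M-grow {a} {m} {a} {suc m} (subst (_≤ k) (sym (+-suc a m)) a+m<k) ≤-refl (+-monoʳ-≤ a (n≤1+n m)) eq w
      (neighbour-window {a} {suc m} (spineAt-spine a+m<k)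
        (subst (a ≤_) (sym (position-spineAt a+m<k)) (m≤m+n a m))
        (subst (_< a + suc m) (sym (position-spineAt a+m<k)) (+-monoʳ-< a (n<1+n m))) x~w)
      (fresh-right 1≤m a+m<k x~w w≢)
  M-suc {m} 1≤m m<k | zero , _ , _ | no m≮k = ⊥-elim (m≮k m<k)
  M-suc {m} 1≤m m<k | suc j , 1+j+m≤k , eq | no 1+j+m≮k
    with spine⇒neighbour≢ (spineAt-spine (<-≤-trans (m<m+n j 1≤m) (≤-trans (n≤1+n _) 1+j+m≤k))) (spineAt (suc j))
  ... | w , x~w , w≢ =
    M-grow {suc j} {m} {j} {suc m} (≤-reflexive (trans (+-suc j m) (≤-antisym 1+j+m≤k (≮⇒≥ 1+j+m≮k))))
           (n≤1+n j) (≤-reflexive (sym (+-suc j m))) eq w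
      (neighbour-window {j} {suc m} (spineAt-spine j<k) (≤-reflexive (sym (position-spineAt j<k)))
        (subst (_< j + suc m) (sym (position-spineAt j<k)) (m<m+n j (s≤s z≤n))) x~w)
      (fresh-left refl (<-≤-trans (m<m+n (suc j) 1≤m) 1+j+m≤k) x~w w≢)
    where j<k = <-≤-trans (m<m+n j 1≤m) (≤-trans (n≤1+n _) 1+j+m≤k)

  -- The window of m₁ + m₂ spine vertices from a is covered by the windows of m₁ of them from a
  -- and of m₂ from a + m₁, which share the spine vertices at positions a + m₁ - 1 and a + m₁.
  M-subadditive : ∀ {m₁ m₂} → 1 ≤ m₁ → 1 ≤ m₂ → m₁ + m₂ ≤ k → M (m₁ + m₂) + 2 ≤ M m₁ + M m₂
  M-subadditive {m₁} {m₂} 1≤m₁ 1≤m₂ m₁+m₂≤k with M-attained m₁+m₂≤k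
  ... | a , a+m≤k , eq = begin
    M (m₁ + m₂) + 2
      ≡⟨ cong (_+ 2) (sym eq) ⟩
    count (inWindow a (m₁ + m₂)) + 2
      ≤⟨ +-mono-≤ (count-mono _ _ (window-+ {a} {m₁} {m₂})) shared ⟩
    count (λ v → W₁ v ∨ W₂ v) + count (λ v → W₁ v ∧ W₂ v)
      ≡⟨ count-∨+count-∧ W₁ W₂ ⟩
    count W₁ + count W₂
      ≤⟨ +-mono-≤ (M-upper {a} {m₁} (≤-trans (+-monoʳ-≤ a (m≤m+n m₁ m₂)) a+m≤k)) (M-upper {b} {m₂} b+m₂≤k) ⟩
    M m₁ + M m₂ ∎
    where
    open ≤-Reasoning
    b = a + m₁
    W₁ = inWindow a m₁
    W₂ = inWindow b m₂
    b+m₂≤k : b + m₂ ≤ k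
    b+m₂≤k = ≤-trans (≤-reflexive (+-assoc a m₁ m₂)) a+m≤k
    r = pred b
    1+r≡b : suc r ≡ b
    1+r≡b = suc-pred b {{>-nonZero (≤-trans 1≤m₁ (m≤n+m m₁ a))}}
    b<k : b < k
    b<k = <-≤-trans (m<m+n b 1≤m₂) b+m₂≤k
    r<k : r < k
    r<k = <-trans (≤-reflexive 1+r≡b) b<k
    shared : 2 ≤ count (λ v → W₁ v ∧ W₂ v)
    shared = count≥2 _
      (∧-intro (spineAt-window {a} {m₁} r<k (≤-trans (m≤m+n a m₁) (≤-reflexive (sym 1+r≡b)))
                                            (≤-trans (n≤1+n r) (≤-reflexive 1+r≡b)))
               (spineAt-window {b} {m₂} r<k (≤-reflexive (sym 1+r≡b))
                                            (≤-trans (n≤1+n r) (≤-trans (≤-reflexive 1+r≡b) (m≤m+n b m₂)))))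
      (∧-intro (spineAt-window {a} {m₁} b<k (≤-trans (m≤m+n a m₁) (n≤1+n b)) ≤-refl)
               (spineAt-window {b} {m₂} b<k (n≤1+n b) (m≤m+n b m₂)))
      (λ eq′ → <-irrefl (trans (sym (position-spineAt r<k))
                                (trans (cong position eq′) (trans (position-spineAt b<k) (sym 1+r≡b))))
                        (n<1+n r))

  -- Induced subtrees lie in windows

  step-below : ∀ {S t u x} → ¬ spineAt t ∈ S → Adj G u x → x ∈ S → position u < t → position x < t
  step-below {S} {t} {u} {x} t∉S u~x x∈S pu<t with spine? u | spine? x
  ... | inj₂ leaf | _ = subst (_< t) (sym (proj₂ (leaf-adjacent u~x leaf))) pu<t
  ... | inj₁ _ | inj₂ leaf = subst (_< t) (proj₂ (leaf-adjacent (Adj-sym G u~x) leaf)) pu<t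
  ... | inj₁ tu | inj₁ tx = ≤∧≢⇒< (≤-trans (spine-adjacent≤ u~x tu tx) pu<t) λ px≡t →
    t∉S (subst (_∈ S) (trans (sym (spineAt-position tx)) (cong spineAt px≡t)) x∈S)

  walk-below : ∀ {S t u w} → ¬ spineAt t ∈ S → WalkIn G S u w → position u < t → position w < t
  walk-below t∉S (here _) pu<t = pu<t
  walk-below t∉S (step _ u~x p) pu<t = walk-below t∉S p (step-below t∉S u~x (WalkIn-source G p) pu<t)

  module Subtree (S : Subset n) (subtree : InducesTree G S) (∣S∣≥3 : 3 ≤ ∣ S ∣) where

    internal : Fin n → Bool
    internal v = lookup S v ∧ not (degIn G S v ≡ᵇ 1)

    private
      internal⁺ : ∀ {v} → v ∈ S → degIn G S v ≢ 1 → T (internal v)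
      internal⁺ v∈S d≢1 = ∧-intro (∈⇒T G {S} v∈S) (not-intro (d≢1 ∘ ≡ᵇ⇒≡ _ _))

      internal⁻ : ∀ {v} → T (internal v) → v ∈ S × degIn G S v ≢ 1
      internal⁻ {v} t = T⇒∈ G (∧-elimˡ {lookup S v} t) , not-elim (∧-elimʳ {lookup S v} t) ∘ ≡⇒≡ᵇ _ _

      internal⇒spine : ∀ {v} → T (internal v) → T (onSpine v)
      internal⇒spine {v} t with spine? v | internal⁻ t
      ... | inj₁ tv | _ = tv
      ... | inj₂ leaf | v∈S , d≢1 with ∣S∣≥2⇒other G (≤-trans (n≤1+n 2) ∣S∣≥3) v∈S
      ...   | u , u∈S , u≢v = ⊥-elim (d≢1 (≤-antisym
                (≤-trans (degIn-mono G {S} (λ {x} _ → ∈-allVertices G x) v)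
                         (≤-reflexive (trans (sym (degree≡degIn v)) (leaf⇒degree≡1 leaf))))
                (connected⇒degIn≥1 G (proj₁ subtree) v∈S u∈S (u≢v ∘ sym))))

      leaf-neighbour-internal : ∀ {x y} → x ∈ S → degIn G S x ≡ 1 → y ∈ S → Adj G x y → T (internal y)
      leaf-neighbour-internal x∈S dx y∈S x~y with degIn G S _ ≟ 1
      ... | yes dy = ⊥-elim (<⇒≱ ∣S∣≥3 (adjacent-leaves⇒∣S∣≤2 G (proj₁ subtree) x∈S y∈S dx dy x~y))
      ... | no dy≢1 = internal⁺ y∈S dy≢1

      some-internal : ∃ λ v → T (internal v)
      some-internal
        with count-witness (lookup S) (≤-trans (s≤s z≤n) (≤-trans ∣S∣≥3 (≤-reflexive (∣p∣≡count S))))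
      ... | x , tx with degIn G S x ≟ 1
      ...   | no dx≢1 = x , internal⁺ (T⇒∈ G tx) dx≢1
      ...   | yes dx with neighbour G {S} (≤-reflexive (sym dx))
      ...     | y , y∈S , x~y = y , leaf-neighbour-internal (T⇒∈ G tx) dx y∈S x~y

      InternalAt : ℕ → Set
      InternalAt j = j < k × T (internal (spineAt j))

      InternalAt? : ∀ j → Dec (InternalAt j)
      InternalAt? j = (j <? k) ×-dec T? (internal (spineAt j))

      some-internalAt : ∃ λ j → j ≤ k × InternalAt j
      some-internalAt = let v , t = some-internal
                            tv = internal⇒spine t in
        position v , <⇒≤ (position<k v) , position<k v , subst (T ∘ internal) (sym (spineAt-position tv)) t

    opaque
      a : ℕ
      a = proj₁ (least InternalAt? k some-internalAt)

      b : ℕ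
      b = proj₁ (greatest InternalAt? k some-internalAt)

      internalAt-a : InternalAt a
      internalAt-a = proj₁ (proj₂ (proj₂ (least InternalAt? k some-internalAt)))

      internalAt-b : InternalAt b
      internalAt-b = proj₁ (proj₂ (proj₂ (greatest InternalAt? k some-internalAt)))

      internal-range : ∀ {v} → T (internal v) → a ≤ position v × position v ≤ b
      internal-range {v} t =
        ≮⇒≥ (λ pv<a → proj₂ (proj₂ (proj₂ (least InternalAt? k some-internalAt))) pv<a at) ,
        ≮⇒≥ (λ b<pv → proj₂ (proj₂ (proj₂ (greatest InternalAt? k some-internalAt))) b<pv (<⇒≤ (position<k v)) at)
        where
        at : InternalAt (position v)
        at = position<k v , subst (T ∘ internal) (sym (spineAt-position (internal⇒spine t))) t

    private
      b<k : b < k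
      b<k = proj₁ internalAt-b

      a≤b : a ≤ b
      a≤b = subst (a ≤_) (position-spineAt b<k) (proj₁ (internal-range (proj₂ internalAt-b)))

      spine-convex : ∀ {t} → a ≤ t → t ≤ b → spineAt t ∈ S
      spine-convex {t} a≤t t≤b with spineAt t ∈? S
      ... | yes t∈S = t∈S
      ... | no t∉S = ⊥-elim (<⇒≱ (subst (_< t) (position-spineAt b<k)
                                          (walk-below t∉S (proj₁ subtree _ _ a∈S b∈S)
                                                      (subst (_< t) (sym (position-spineAt a<k)) a<t))) t≤b)
        where
        a∈S = proj₁ (internal⁻ (proj₂ internalAt-a))
        b∈S = proj₁ (internal⁻ (proj₂ internalAt-b))
        a<k = proj₁ internalAt-a
        a<t : a < t
        a<t = ≤∧≢⇒< a≤t λ { refl → t∉S a∈S }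

      -- strictly between a and b, a spine vertex has both spine neighbours in S
      spine-internal : ∀ {t} → a ≤ t → t ≤ b → T (internal (spineAt t))
      spine-internal {t} a≤t t≤b with a <? t | t <? b
      ... | no a≮t | _ = subst (T ∘ internal ∘ spineAt) (≤-antisym a≤t (≮⇒≥ a≮t)) (proj₂ internalAt-a)
      ... | yes _ | no t≮b = subst (T ∘ internal ∘ spineAt) (≤-antisym (≮⇒≥ t≮b) t≤b) (proj₂ internalAt-b)
      spine-internal {suc t} a≤t t≤b | yes a<1+t | yes 1+t<b =
        internal⁺ (spine-convex a≤t t≤b) λ d≡1 → <⇒≱ (degIn≥2 G
          (spine-convex (≤-pred a<1+t) (≤-trans (n≤1+n t) t≤b))
          (Adj-sym G (spineAt-adjacent 1+t<k))
          (spine-convex (≤-trans a≤t (n≤1+n _)) 1+t<b)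
          (spineAt-adjacent 2+t<k)
          (λ eq → <-irrefl (trans (sym (position-spineAt (<-trans (n<1+n t) 1+t<k)))
                                  (trans (cong position eq) (position-spineAt 2+t<k)))
                           (≤-trans (n<1+n t) (n≤1+n _))))
          (≤-reflexive d≡1)
        where
        2+t<k : suc (suc t) < k
        2+t<k = ≤-<-trans 1+t<b b<k
        1+t<k : suc t < k
        1+t<k = <-trans (n<1+n (suc t)) 2+t<k

    ℓ : ℕ
    ℓ = suc (b ∸ a)

    private
      a+ℓ≡1+b : a + ℓ ≡ suc b
      a+ℓ≡1+b = trans (+-suc a (b ∸ a)) (cong suc (m+[n∸m]≡n a≤b))

    1≤ℓ : 1 ≤ ℓ
    1≤ℓ = s≤s z≤n

    ⊆window : ∀ {v} → v ∈ S → T (inWindow a ℓ v)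
    ⊆window {v} v∈S with degIn G S v ≟ 1
    ... | no dv≢1 = let t = internal⁺ v∈S dv≢1
                        a≤pv , pv≤b = internal-range t in
      window-spine⁺ {a} {ℓ} (internal⇒spine t) (≤-trans a≤pv (n≤1+n _))
                             (≤-trans pv≤b (≤-trans (n≤1+n b) (≤-reflexive (sym a+ℓ≡1+b))))
    ... | yes dv with neighbour G {S} (≤-reflexive (sym dv))
    ...   | y , y∈S , v~y = let t = leaf-neighbour-internal v∈S dv y∈S v~y
                                a≤py , py≤b = internal-range t in
      neighbour-window {a} {ℓ} (internal⇒spine t) a≤py (≤-trans (s≤s py≤b) (≤-reflexive (sym a+ℓ≡1+b)))
                       (Adj-sym G v~y)

    ∣S∣≤Mℓ : ∣ S ∣ ≤ M ℓ
    ∣S∣≤Mℓ = begin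
      ∣ S ∣                  ≡⟨ ∣p∣≡count S ⟩
      count (lookup S)       ≤⟨ count-mono (lookup S) (inWindow a ℓ) (λ v t → ⊆window {v} (T⇒∈ G {S} t)) ⟩
      count (inWindow a ℓ)   ≤⟨ M-upper {a} {ℓ} (≤-trans (≤-reflexive a+ℓ≡1+b) b<k) ⟩
      M ℓ ∎
      where open ≤-Reasoning

    ℓ+leaves≤∣S∣ : ℓ + leavesIn G S ≤ ∣ S ∣
    ℓ+leaves≤∣S∣ = begin
      ℓ + leavesIn G S                            ≤⟨ +-mono-≤ ℓ≤internal (≤-reflexive (leavesIn≡count G S)) ⟩
      count internal + count (λ v → lookup S v ∧ (degIn G S v ≡ᵇ 1))
                                                  ≡⟨ +-comm (count internal) _ ⟩
      count (λ v → lookup S v ∧ (degIn G S v ≡ᵇ 1)) + count internal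
                                                  ≡⟨ sym (count-split (lookup S) (λ v → degIn G S v ≡ᵇ 1)) ⟩
      count (lookup S)                            ≡⟨ sym (∣p∣≡count S) ⟩
      ∣ S ∣ ∎
      where
      open ≤-Reasoning
      ℓ≤internal : ℓ ≤ count internal
      ℓ≤internal = count≥-onto internal (λ v → position v ∸ a) ℓ λ t t<ℓ →
        let a+t≤b : a + t ≤ b
            a+t≤b = ≤-pred (≤-trans (+-monoʳ-< a t<ℓ) (≤-reflexive a+ℓ≡1+b)) in
        spineAt (a + t) , spine-internal (m≤m+n a t) a+t≤b ,
        trans (cong (_∸ a) (position-spineAt (≤-<-trans a+t≤b b<k))) (m+n∸m≡n a t)

  K : ℕ
  K = pred k

  private
    1+K≡k : suc K ≡ k
    1+K≡k = suc-pred k {{>-nonZero k≥1}}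

  module Sizes = WindowSizes n K M M-1
    (λ {m} 1≤m m<1+K → M-suc 1≤m (subst (m <_) 1+K≡k m<1+K))
    (λ {a} {b} 1≤a 1≤b a+b≤1+K → M-subadditive 1≤a 1≤b (subst (a + b ≤_) 1+K≡k a+b≤1+K))
    (trans (cong M 1+K≡k) M-k)

  IsLG-leastCover : ∀ {s m} → 3 ≤ s → Sizes.IsLeastCover s m → IsLG G s (s ∸ m)
  IsLG-leastCover {s} {m} 3≤s cover@(1≤m , m≤1+K , s≤Mm , _) with M-realised 1≤m (subst (m ≤_) 1+K≡k m≤1+K)
  ... | S₀ , subtree₀ , ∣S₀∣≡Mm , Mm≤ with pruneLeaves G tree (M m ∸ s) S₀ (proj₁ subtree₀)
                                             (trans ∣S₀∣≡Mm (sym (m+[n∸m]≡n s≤Mm)))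
                                             (subst (_≤ leavesIn G S₀ + m) (sym (m+[n∸m]≡n s≤Mm)) Mm≤)
                                             (Sizes.leastCover+2≤ 3≤s cover)
  ...   | S , subtree , ∣S∣≡s , s≤ =
    (S , subtree , ∣S∣≡s ,
     ≤-antisym (at-most S subtree ∣S∣≡s) (m≤n+o⇒m∸n≤o s m (subst (s ≤_) (+-comm _ m) s≤))) ,
    at-most
    where
    at-most : ∀ S → InducesTree G S → ∣ S ∣ ≡ s → leavesIn G S ≤ s ∸ m
    at-most S subtree ∣S∣≡s = m+n≤o⇒m≤o∸n (leavesIn G S) (begin
      leavesIn G S + m
        ≤⟨ +-monoʳ-≤ (leavesIn G S) (Sizes.leastCover-minimal cover T.1≤ℓ (subst (_≤ M T.ℓ) ∣S∣≡s T.∣S∣≤Mℓ)) ⟩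
      leavesIn G S + T.ℓ
        ≡⟨ +-comm (leavesIn G S) T.ℓ ⟩
      T.ℓ + leavesIn G S
        ≤⟨ T.ℓ+leaves≤∣S∣ ⟩
      ∣ S ∣
        ≡⟨ ∣S∣≡s ⟩
      s ∎)
      where
      open ≤-Reasoning
      module T = Subtree S subtree (subst (3 ≤_) (sym ∣S∣≡s) 3≤s)

  leafWord : IsLeafWord G Sizes.word
  leafWord = length-segment Sizes.letter 0 (n ∸ 3) , λ x →
    let x<N = subst (toℕ x <_) (length-segment Sizes.letter 0 (n ∸ 3)) (Fin.toℕ<n x)
        x+3<n : toℕ x + 3 < n
        x+3<n = m≤o∸n⇒m+n≤o (suc (toℕ x)) n≥3 x<N
        m , cover = Sizes.leastCover (<⇒≤ x+3<n)
        m′ , cover′ = Sizes.leastCover (subst (_≤ n) (sym (+-suc (toℕ x) 3)) x+3<n)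
    in (toℕ x + 3) ∸ m , (toℕ x + 4) ∸ m′ ,
       IsLG-leastCover (m≤n+m 3 (toℕ x)) cover , IsLG-leastCover (≤-trans (n≤1+n 3) (m≤n+m 4 (toℕ x))) cover′ ,
       trans (Sizes.letter-step x+3<n cover cover′)
             (cong (λ b → (toℕ x + 3) ∸ m + (if b then 1 else 0)) (sym (lookup-segment Sizes.letter 0 (n ∸ 3) x)))

prefixNormal-[] : PrefixNormal []
prefixNormal-[] zero zero _ = z≤n

proposition4 : ∀ (n : ℕ) (C : Graph n) → IsCaterpillar C →
    Σ (List Bool) λ w → IsLeafWord C w × PrefixNormal w
proposition4 n C (tree , spine) with 3 ≤? n
... | yes n≥3 = Sizes.word , leafWord , Sizes.word-prefixNormal
  where open Caterpillar C tree n≥3 spine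
... | no n≱3 = [] , (sym (m≤n⇒m∸n≡0 (<⇒≤ (≰⇒> n≱3))) , λ ()) , prefixNormal-[]
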